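{- Let $\mathbb{F}$ be an ordered field and fix a coefficient matrix $[a_{ij}]\in M_{n\times m}(\mathbb{F})$ (one for each arrangement below, possibly different). Let $\mathcal{H}_1=\{H^1_1,\ldots,H^1_n\}$ with $H^1_i:\sum_j a_{ij}x_j=b_i$ and $\mathcal{H}_2=\{H^2_1,\ldots,H^2_n\}$ with $H^2_i:\sum_j a'_{ij}x_j=c_i$ be hyperplane arrangements in $\mathbb{F}^m$ which are isomorphic by an isomorphism that is the identity on subscripts. Let $\mathcal{C}_1,\mathcal{C}_2$ be their concurrency arrangements in $\mathbb{F}^n$, and suppose $(b_1,\ldots,b_n)$ and $(c_1,\ldots,c_n)$ lie in the interiors of cones (regions) of $\mathcal{C}_1$ and $\mathcal{C}_2$ respectively. Suppose the indices $i_1<\cdots<i_{m+1}$ give rise to an $m$-dimensional simplex polyhedrality of both arrangements. Suppose $(b_1,\ldots,b_n)$ and $(c_1,\ldots,c_n)$ are moved, each crossing only the single boundary hyperplane $M_{\{i_1,\ldots,i_{m+1}\}}$ of its cone, to points $(\tilde b_1,\ldots,\tilde b_n)$ and $(\tilde c_1,\ldots,\tilde c_n)$ in the interiors of the adjacent cones, giving new arrangements $\tilde{\mathcal{H}}_1=\{\sum_j a_{ij}x_j=\tilde b_i\}$ and $\tilde{\mathcal{H}}_2=\{\sum_j a'_{ij}x_j=\tilde c_i\}$. Then $\tilde{\mathcal{H}}_1$ and $\tilde{\mathcal{H}}_2$ are isomorphic by an isomorphism which is the identity on subscripts.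
   Context: An ordered field is a totally ordered field with $x\le y\Rightarrow x+z\le y+z$ and $x,y\ge0\Rightarrow xy\ge 0$. A hyperplane arrangement (in general position) in $\mathbb{F}^m$: any $r\le m$ distinct hyperplanes meet in an affine subspace of dimension $m-r$, and any $r>m$ distinct ones have empty intersection. For an arrangement $H_i:\sum_j a_{ij}x_j=b_i$, the concurrency arrangement is the set of linear hyperplanes in $\mathbb{F}^n$ (coordinates $y_1,\ldots,y_n$) $M_{\{i_1,\ldots,i_{m+1}\}}$, for $i_1<\cdots<i_{m+1}$, defined by $\det=0$ of the $(m+1)\times(m+1)$ matrix whose $k$-th row is $(a_{i_k1},\ldots,a_{i_km},y_{i_k})$; it depends only on the coefficient matrix. A set of $m+1$ hyperplanes $H_{i_1},\ldots,H_{i_{m+1}}$ gives rise to an $m$-dimensional simplex polyhedrality if some choice of the inequalities $\sum_ja_{i_kj}x_j\le b_{i_k}$ or $\ge b_{i_k}$ ($k=1,\ldots,m+1$) defines a bounded nonempty region of the whole arrangement, where a region $R$ is unbounded if there are $u,v\in R$ with $v+t(u-v)\in R$ for all $t\ge0$ or for all $t\le 0$. Two arrangements $\{H^1_i\},\{H^2_i\}$ are isomorphic by an isomorphism which is the identity on subscripts if for every $(m-1)$-subset $S$ of indices, the linear order of the vertices $\bigcap_{i\in S\cup\{j\}}H^1_i$ on the line $\bigcap_{i\in S}H^1_i$ coincides (up to reversal) with that of the vertices $\bigcap_{i\in S\cup\{j\}}H^2_i$ on $\bigcap_{i\in S}H^2_i$. -}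

module Defs where

open import Level using (Level; _⊔_) renaming (suc to lsuc)
open import Algebra.Bundles using (CommutativeRing)
open import Relation.Binary.Core using (Rel)
open import Relation.Binary.Structures using (IsTotalOrder)
open import Relation.Binary.PropositionalEquality using (_≡_)
open import Relation.Nullary using (¬_)
open import Data.Nat using (ℕ; zero; suc) renaming (_+_ to _+ℕ_)
open import Data.Nat using () renaming (_≤_ to _≤ℕ_; _<_ to _<ℕ_)
open import Data.Fin using (Fin; zero; suc; punchIn) renaming (_<_ to _<ᶠ_)
open import Data.Product using (Σ; ∃; _×_; _,_)
open import Data.Sum using (_⊎_)
open import Function.Definitions using (Injective)

record OrderedField (c ℓ₁ ℓ₂ : Level) : Set (lsuc (c ⊔ ℓ₁ ⊔ ℓ₂)) where
  field
    commutativeRing : CommutativeRing c ℓ₁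
  open CommutativeRing commutativeRing public
  field
    _≤_          : Rel Carrier ℓ₂
    isTotalOrder : IsTotalOrder _≈_ _≤_
    0≉1          : ¬ (0# ≈ 1#)
    inverse      : ∀ x → ¬ (x ≈ 0#) → ∃ λ y → x * y ≈ 1#
    +-mono-≤     : ∀ {x y} z → x ≤ y → (x + z) ≤ (y + z)
    *-nonneg     : ∀ {x y} → 0# ≤ x → 0# ≤ y → 0# ≤ (x * y)

  _<_ : Rel Carrier (ℓ₁ ⊔ ℓ₂)
  x < y = (x ≤ y) × ¬ (x ≈ y)

module Geometry {c ℓ₁ ℓ₂} (𝔽 : OrderedField c ℓ₁ ℓ₂) where
  open OrderedField 𝔽 hiding (zero)

  Pt : ℕ → Set c
  Pt k = Fin k → Carrier

  sumFin : ∀ {k} → (Fin k → Carrier) → Carrier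
  sumFin {zero}  f = 0#
  sumFin {suc k} f = f zero + sumFin (λ i → f (suc i))

  _≈ᵥ_ : ∀ {k} → Pt k → Pt k → Set ℓ₁
  x ≈ᵥ y = ∀ j → x j ≈ y j

  0ᵥ : ∀ {k} → Pt k
  0ᵥ _ = 0#

  sgnFin : ∀ {k} → Fin k → Carrier
  sgnFin zero    = 1#
  sgnFin (suc i) = - sgnFin i

  det : ∀ {k} → (Fin k → Fin k → Carrier) → Carrier
  det {zero}  M = 1#
  det {suc k} M = sumFin (λ i → sgnFin i * (M i zero * det (λ r s → M (punchIn i r) (suc s))))

  Subset𝔽 : ℕ → Set (c ⊔ lsuc ℓ₁)
  Subset𝔽 k = Pt k → Set ℓ₁

  LinIndep : ∀ {k d} → (Fin d → Pt k) → Set (c ⊔ ℓ₁)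
  LinIndep {k} {d} v =
    ∀ (t : Fin d → Carrier) → (λ j → sumFin (λ l → t l * v l j)) ≈ᵥ 0ᵥ → ∀ l → t l ≈ 0#

  AffineOfDim : ∀ {k} → Subset𝔽 k → ℕ → Set (c ⊔ ℓ₁)
  AffineOfDim {k} X d =
    Σ (Pt k) λ p → Σ (Fin d → Pt k) λ v → LinIndep v ×
      (∀ x → (X x → ∃ λ (t : Fin d → Carrier) → x ≈ᵥ (λ j → p j + sumFin (λ l → t l * v l j)))
           × ((∃ λ (t : Fin d → Carrier) → x ≈ᵥ (λ j → p j + sumFin (λ l → t l * v l j))) → X x))

  OnH : ∀ {n m} → (Fin n → Pt m) → Pt n → Fin n → Pt m → Set ℓ₁
  OnH A b i x = sumFin (λ j → A i j * x j) ≈ b i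

  Meet : ∀ {n m r} → (Fin n → Pt m) → Pt n → (Fin r → Fin n) → Subset𝔽 m
  Meet A b σ x = ∀ l → OnH A b (σ l) x

  GeneralPosition : ∀ {n m} → (Fin n → Pt m) → Pt n → Set (c ⊔ ℓ₁)
  GeneralPosition {n} {m} A b =
    ∀ r (σ : Fin r → Fin n) → Injective _≡_ _≡_ σ →
      ((r ≤ℕ m) → ∀ d → r +ℕ d ≡ m → AffineOfDim (Meet A b σ) d)
      × ((m <ℕ r) → ∀ x → ¬ Meet A b σ x)

  -- Concurrency arrangement: for i_1 < ... < i_{m+1} (a strictly
  -- increasing I : Fin (suc m) → Fin n), the linear form on F^n
  --   y ↦ det [ a_{i_k 1} … a_{i_k m}  y_{i_k} ]_k

  StrictlyIncreasing : ∀ {r n} → (Fin r → Fin n) → Set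
  StrictlyIncreasing I = ∀ {k l} → k <ᶠ l → I k <ᶠ I l

  snoc : ∀ {m} → Pt m → Carrier → Pt (suc m)
  snoc {zero}  v a zero    = a
  snoc {suc m} v a zero    = v zero
  snoc {suc m} v a (suc j) = snoc (λ i → v (suc i)) a j

  concDet : ∀ {n m} → (Fin n → Pt m) → (Fin (suc m) → Fin n) → Pt n → Carrier
  concDet A I y = det (λ k → snoc (A (I k)) (y (I k)))

  -- y lies in the interior of a cone (region) of the concurrency
  -- arrangement of A: y lies on none of the hyperplanes M_I
  InConeInterior : ∀ {n m} → (Fin n → Pt m) → Pt n → Set (ℓ₁)
  InConeInterior {n} {m} A y =
    ∀ (I : Fin (suc m) → Fin n) → StrictlyIncreasing I → ¬ (concDet A I y ≈ 0#)

  SameSign : Carrier → Carrier → Set (ℓ₁ ⊔ ℓ₂)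
  SameSign u v = ((0# < u) × (0# < v)) ⊎ ((u < 0#) × (v < 0#))

  OppositeSign : Carrier → Carrier → Set (ℓ₁ ⊔ ℓ₂)
  OppositeSign u v = ((0# < u) × (v < 0#)) ⊎ ((u < 0#) × (0# < v))

  CrossesOnly : ∀ {n m} → (Fin n → Pt m) → (Fin (suc m) → Fin n) → Pt n → Pt n → Set (ℓ₁ ⊔ ℓ₂)
  CrossesOnly {n} {m} A I y ỹ =
    InConeInterior A ỹ
    × (∀ (J : Fin (suc m) → Fin n) → StrictlyIncreasing J → ¬ (∀ k → J k ≡ I k) →
         SameSign (concDet A J y) (concDet A J ỹ))
    × OppositeSign (concDet A I y) (concDet A I ỹ)

  data Side : Set where
    le ge : Side

  InHalf : ∀ {n m} → (Fin n → Pt m) → Pt n → Fin n → Side → Pt m → Set ℓ₂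
  InHalf A b i le x = sumFin (λ j → A i j * x j) ≤ b i
  InHalf A b i ge x = b i ≤ sumFin (λ j → A i j * x j)

  Cell : ∀ {n m r} → (Fin n → Pt m) → Pt n → (Fin r → Fin n) → (Fin r → Side) → Pt m → Set ℓ₂
  Cell A b τ s x = ∀ l → InHalf A b (τ l) (s l) x

  Unbounded : ∀ {m} → (Pt m → Set ℓ₂) → Set (c ⊔ ℓ₁ ⊔ ℓ₂)
  Unbounded {m} R =
    Σ (Pt m) λ u → Σ (Pt m) λ v → R u × R v × ¬ (u ≈ᵥ v) ×
      ((∀ t → 0# ≤ t → R (λ j → v j + t * (u j - v j)))
       ⊎ (∀ t → t ≤ 0# → R (λ j → v j + t * (u j - v j))))

  Bounded : ∀ {m} → (Pt m → Set ℓ₂) → Set (c ⊔ ℓ₁ ⊔ ℓ₂)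
  Bounded R = ¬ Unbounded R

  RegionOf : ∀ {n m} → (Fin n → Pt m) → Pt n → (Pt m → Set ℓ₂) → Set (c ⊔ ℓ₂)
  RegionOf {n} {m} A b R =
    (Σ (Fin n → Side) λ σ → ∀ x → (R x → Cell A b (λ i → i) σ x) × (Cell A b (λ i → i) σ x → R x))
    × (Σ (Pt m) R)

  SimplexPolyhedrality : ∀ {n m} → (Fin n → Pt m) → Pt n → (Fin (suc m) → Fin n) → Set (c ⊔ ℓ₁ ⊔ ℓ₂)
  SimplexPolyhedrality {n} {m} A b I =
    Σ (Fin (suc m) → Side) λ s → RegionOf A b (Cell A b I s) × Bounded (Cell A b I s)

  addIdx : ∀ {d n} → (Fin d → Fin n) → Fin n → Fin (suc d) → Fin n
  addIdx S j zero    = j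
  addIdx S j (suc l) = S l

  Precedes : ∀ {m} → Pt m → Pt m → Pt m → Pt m → Set (c ⊔ ℓ₁ ⊔ ℓ₂)
  Precedes p q x y = ∃ λ t → (0# < t) × (y ≈ᵥ (λ j → x j + t * (q j - p j)))

  -- for every (m-1)-subset S, the orders of the vertices
  -- ⋂_{S ∪ {j}} H_i on the line ⋂_S H_i agree up to reversal
  -- (reversal = choosing the opposite orientation p' , q' of the second line)
  IsoId : ∀ {n d} → (Fin n → Pt (suc d)) → Pt n → (Fin n → Pt (suc d)) → Pt n → Set (c ⊔ ℓ₁ ⊔ ℓ₂)
  IsoId {n} {d} A b A′ c′ =
    ∀ (S : Fin d → Fin n) → Injective _≡_ _≡_ S →
      Σ (Pt (suc d)) λ p → Σ (Pt (suc d)) λ q →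
      Σ (Pt (suc d)) λ p′ → Σ (Pt (suc d)) λ q′ →
        Meet A b S p × Meet A b S q × ¬ (p ≈ᵥ q) ×
        Meet A′ c′ S p′ × Meet A′ c′ S q′ × ¬ (p′ ≈ᵥ q′) ×
        (∀ j k → (∀ l → ¬ (S l ≡ j)) → (∀ l → ¬ (S l ≡ k)) →
          ∀ x y x′ y′ →
            Meet A b (addIdx S j) x → Meet A b (addIdx S k) y →
            Meet A′ c′ (addIdx S j) x′ → Meet A′ c′ (addIdx S k) y′ →
            (Precedes p q x y → Precedes p′ q′ x′ y′) × (Precedes p′ q′ x′ y′ → Precedes p q x y))

-- For an (m-1)-subset S of the hyperplanes and j, k outside S, let x and y be the vertices
-- S ∪ {j} and S ∪ {k} on the line ⋂_S, and let w be a direction of that line. If J enumerates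
-- S ∪ {j, k}, expanding the concurrency determinant gives M_J(b) = (a_k · (y - x)) · M_J(e_k),
-- and y - x = s w; hence x precedes y along w iff M_J(b) has the sign of the constant
-- κ = (a_k · w) · M_J(e_k), which depends on the coefficients only. Crossing exactly the wall
-- M_I flips the sign of M_J(b) iff J = I, in both arrangements at once. So, comparing vertices
-- on new lines parallel to the old ones, every order on a line is reversed in both
-- arrangements or in neither, and the isomorphism survives.

module Submission where

open import Defs
open import Level using (Level)
open import Data.Nat using (ℕ; suc)
open import Data.Fin using (Fin)

open import Level using (_⊔_)
open import Data.Maybe using (Maybe; nothing; just)
open import Data.Nat as ℕ using (zero; s<s)
import Data.Nat.Properties as ℕₚ
open import Data.Integer as ℤ using (ℤ; +_; -[1+_]; _⊖_)
import Data.Integer.Properties as ℤₚ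
open import Data.Fin as Fin using (zero; suc; punchIn; inject₁; fromℕ; _↑ʳ_)
import Data.Fin.Properties as Finₚ
open import Data.Vec using (Vec; []; _∷_; lookup)
open import Data.Vec.Relation.Unary.All as All using (All; []; _∷_)
import Data.Vec.Relation.Unary.All.Properties as Allₚ
open import Data.Vec.Relation.Unary.AllPairs using (AllPairs; []; _∷_)
open import Data.Product using (Σ; ∃; _×_; _,_; proj₁; proj₂)
open import Data.Sum using (_⊎_; inj₁; inj₂)
open import Data.Empty using (⊥; ⊥-elim)
open import Relation.Binary.PropositionalEquality as ≡ using (_≡_; _≢_)
open import Relation.Binary.Definitions using (tri<; tri≈; tri>)
open import Relation.Binary.Structures using (IsTotalOrder)
open import Relation.Nullary using (¬_; yes; no)
open import Function.Base using (_∘_)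
open import Function.Definitions using (Injective)
open import Function.Bundles using (_⇔_; mk⇔; module Equivalence)
import Function.Properties.Equivalence as ⇔
import Algebra.Solver.Ring.AlmostCommutativeRing as ACR

-- Increasing enumerations of sets of indices

Sorted : ∀ {n r} → Vec (Fin n) r → Set
Sorted = AllPairs Fin._<_

insert : ∀ {n r} → Fin n → Vec (Fin n) r → Vec (Fin n) (suc r)
insert a [] = a ∷ []
insert a (h ∷ t) with a Finₚ.<? h
... | yes _ = a ∷ h ∷ t
... | no  _ = h ∷ insert a t

insert⁺ : ∀ {n r p} {P : Fin n → Set p} {a} {v : Vec (Fin n) r} → P a → All P v → All P (insert a v)
insert⁺ pa [] = pa ∷ []
insert⁺ {a = a} {h ∷ _} pa (ph ∷ pt) with a Finₚ.<? h
... | yes _ = pa ∷ ph ∷ pt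
... | no  _ = ph ∷ insert⁺ pa pt

insert-sorted : ∀ {n r} {a : Fin n} {v : Vec (Fin n) r} → All (_≢ a) v → Sorted v → Sorted (insert a v)
insert-sorted [] [] = [] ∷ []
insert-sorted {a = a} {h ∷ _} (h≢a ∷ t≢a) (h<t ∷ sorted) with a Finₚ.<? h
... | yes a<h = (a<h ∷ All.map (Finₚ.<-trans a<h) h<t) ∷ h<t ∷ sorted
... | no  a≮h = insert⁺ h<a h<t ∷ insert-sorted t≢a sorted
  where
  h<a : h Fin.< a
  h<a = Finₚ.≤∧≢⇒< (ℕₚ.≮⇒≥ a≮h) h≢a

sort : ∀ {r n} → (Fin r → Fin n) → Vec (Fin n) r
sort {zero}  K = []
sort {suc r} K = insert (K zero) (sort (λ l → K (suc l)))

sort-⊆-image : ∀ {r n} (K : Fin r → Fin n) → All (λ a → ∃ λ l → a ≡ K l) (sort K)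
sort-⊆-image {zero}  K = []
sort-⊆-image {suc r} K =
  insert⁺ (zero , ≡.refl) (All.map (λ { (l , e) → suc l , e }) (sort-⊆-image (λ l → K (suc l))))

sort-sorted : ∀ {r n} (K : Fin r → Fin n) → Injective _≡_ _≡_ K → Sorted (sort K)
sort-sorted {zero}  K inj = []
sort-sorted {suc r} K inj =
  insert-sorted (All.map (λ { (l , e) e′ → Finₚ.0≢1+n (inj (≡.trans (≡.sym e′) e)) }) (sort-⊆-image (λ l → K (suc l))))
                (sort-sorted (λ l → K (suc l)) (λ e → Finₚ.suc-injective (inj e)))

sorted⇒lookup-increasing : ∀ {r n} {v : Vec (Fin n) r} → Sorted v → ∀ {k l} → k Fin.< l → lookup v k Fin.< lookup v l
sorted⇒lookup-increasing (h<t ∷ _)      {zero}  {suc l} _       = Allₚ.lookup⁺ h<t l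
sorted⇒lookup-increasing (_ ∷ sorted) {suc k} {suc l} (s<s k<l) = sorted⇒lookup-increasing sorted k<l

increasingEnumeration : ∀ {r n} (K : Fin r → Fin n) → Injective _≡_ _≡_ K →
  Σ (Fin r → Fin n) λ J → (∀ {k l} → k Fin.< l → J k Fin.< J l) × (∀ l → ∃ λ l′ → J l ≡ K l′)
increasingEnumeration K inj =
  lookup (sort K) , sorted⇒lookup-increasing (sort-sorted K inj) , Allₚ.lookup⁺ (sort-⊆-image K)

increasing⇒injective : ∀ {r n} (J : Fin r → Fin n) → (∀ {k l} → k Fin.< l → J k Fin.< J l) → Injective _≡_ _≡_ J
increasing⇒injective J inc {k} {l} e with Finₚ.<-cmp k l
... | tri< k<l _ _ = ⊥-elim (Finₚ.<-irrefl e (inc k<l))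
... | tri≈ _ k≡l _ = k≡l
... | tri> _ _ l<k = ⊥-elim (Finₚ.<-irrefl (≡.sym e) (inc l<k))

module _ {c ℓ₁ ℓ₂} (𝔽 : OrderedField c ℓ₁ ℓ₂) where

  open OrderedField 𝔽 hiding (zero)
  open Geometry 𝔽
  open import Algebra.Properties.Monoid.Mult +-monoid using (×-homo-+) renaming (_×_ to _×ₘ_)
  open import Algebra.Properties.Semiring.Mult semiring using (×1-homo-*)
  open import Algebra.Properties.Ring ring using (-‿involutive; -‿distribˡ-*; -‿distribʳ-*; -0#≈0#; -‿+-comm)
  open import Relation.Binary.Reasoning.Setoid setoid

  fromℤ : ℤ → Carrier
  fromℤ (+ n)    = n ×ₘ 1#
  fromℤ -[1+ n ] = - (suc n ×ₘ 1#)

  abstract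
    fromℤ-neg : ∀ z → fromℤ (ℤ.- z) ≈ - fromℤ z
    fromℤ-neg (+ zero)  = sym -0#≈0#
    fromℤ-neg (+ suc n) = refl
    fromℤ-neg -[1+ n ]  = sym (-‿involutive _)

    fromℤ-⊖ : ∀ m n → fromℤ (m ⊖ n) ≈ m ×ₘ 1# - n ×ₘ 1#
    fromℤ-⊖ zero n = begin
      fromℤ (zero ⊖ n)  ≡⟨ ≡.cong fromℤ (ℤₚ.⊖-≤ {0} {n} ℕ.z≤n) ⟩
      fromℤ (ℤ.- + n)   ≈⟨ fromℤ-neg (+ n) ⟩
      - (n ×ₘ 1#)       ≈⟨ +-identityˡ _ ⟨
      0# - n ×ₘ 1#      ∎
    fromℤ-⊖ (suc m) zero = sym (trans (+-congˡ -0#≈0#) (+-identityʳ _))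
    fromℤ-⊖ (suc m) (suc n) = begin
      fromℤ (suc m ⊖ suc n)              ≡⟨ ≡.cong fromℤ (ℤₚ.[1+m]⊖[1+n]≡m⊖n m n) ⟩
      fromℤ (m ⊖ n)                      ≈⟨ fromℤ-⊖ m n ⟩
      m ×ₘ 1# - n ×ₘ 1#                  ≈⟨ +-identityˡ _ ⟨
      0# + (m ×ₘ 1# - n ×ₘ 1#)           ≈⟨ +-congʳ (-‿inverseʳ 1#) ⟨
      (1# - 1#) + (m ×ₘ 1# - n ×ₘ 1#)    ≈⟨ interchange 1# (- 1#) (m ×ₘ 1#) (- (n ×ₘ 1#)) ⟩
      (1# + m ×ₘ 1#) + (- 1# - n ×ₘ 1#)  ≈⟨ +-congˡ (-‿+-comm 1# (n ×ₘ 1#)) ⟩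
      (1# + m ×ₘ 1#) - (1# + n ×ₘ 1#)    ∎
      where
      interchange : ∀ a b c d → (a + b) + (c + d) ≈ (a + c) + (b + d)
      interchange a b c d = begin
        (a + b) + (c + d)  ≈⟨ +-assoc a b (c + d) ⟩
        a + (b + (c + d))  ≈⟨ +-congˡ (+-assoc b c d) ⟨
        a + ((b + c) + d)  ≈⟨ +-congˡ (+-congʳ (+-comm b c)) ⟩
        a + ((c + b) + d)  ≈⟨ +-congˡ (+-assoc c b d) ⟩
        a + (c + (b + d))  ≈⟨ +-assoc a c (b + d) ⟨
        (a + c) + (b + d)  ∎

    fromℤ-+ : ∀ x y → fromℤ (x ℤ.+ y) ≈ fromℤ x + fromℤ y
    fromℤ-+ (+ m) (+ n) = ×-homo-+ 1# m n
    fromℤ-+ (+ m) -[1+ n ] = fromℤ-⊖ m (suc n)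
    fromℤ-+ -[1+ m ] (+ n) = trans (fromℤ-⊖ n (suc m)) (+-comm _ _)
    fromℤ-+ -[1+ m ] -[1+ n ] = begin
      - (suc (suc (m ℕ.+ n)) ×ₘ 1#)   ≡⟨ ≡.cong (λ k → - (suc k ×ₘ 1#)) (≡.sym (ℕₚ.+-suc m n)) ⟩
      - ((suc m ℕ.+ suc n) ×ₘ 1#)     ≈⟨ -‿cong (×-homo-+ 1# (suc m) (suc n)) ⟩
      - (suc m ×ₘ 1# + suc n ×ₘ 1#)   ≈⟨ -‿+-comm _ _ ⟨
      - (suc m ×ₘ 1#) - suc n ×ₘ 1#   ∎

    fromℤ-* : ∀ x y → fromℤ (x ℤ.* y) ≈ fromℤ x * fromℤ y
    fromℤ-* (+ m) (+ n) = trans (reflexive (≡.cong fromℤ (ℤₚ.+◃n≡+n (m ℕ.* n)))) (×1-homo-* m n)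
    fromℤ-* (+ m) -[1+ n ] = begin
      fromℤ (+ m ℤ.* -[1+ n ])           ≡⟨ ≡.cong fromℤ (ℤₚ.-◃n≡-n (m ℕ.* suc n)) ⟩
      fromℤ (ℤ.- + (m ℕ.* suc n))        ≈⟨ fromℤ-neg (+ (m ℕ.* suc n)) ⟩
      - ((m ℕ.* suc n) ×ₘ 1#)            ≈⟨ -‿cong (×1-homo-* m (suc n)) ⟩
      - (m ×ₘ 1# * suc n ×ₘ 1#)          ≈⟨ -‿distribʳ-* _ _ ⟩
      m ×ₘ 1# * - (suc n ×ₘ 1#)          ∎
    fromℤ-* -[1+ m ] (+ n) = begin
      fromℤ (-[1+ m ] ℤ.* + n)           ≡⟨ ≡.cong fromℤ (ℤₚ.-◃n≡-n (suc m ℕ.* n)) ⟩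
      fromℤ (ℤ.- + (suc m ℕ.* n))        ≈⟨ fromℤ-neg (+ (suc m ℕ.* n)) ⟩
      - ((suc m ℕ.* n) ×ₘ 1#)            ≈⟨ -‿cong (×1-homo-* (suc m) n) ⟩
      - (suc m ×ₘ 1# * n ×ₘ 1#)          ≈⟨ -‿distribˡ-* _ _ ⟩
      - (suc m ×ₘ 1#) * n ×ₘ 1#          ∎
    fromℤ-* -[1+ m ] -[1+ n ] = begin
      (suc m ℕ.* suc n) ×ₘ 1#            ≈⟨ ×1-homo-* (suc m) (suc n) ⟩
      suc m ×ₘ 1# * suc n ×ₘ 1#          ≈⟨ -‿involutive _ ⟨
      - - (suc m ×ₘ 1# * suc n ×ₘ 1#)    ≈⟨ -‿cong (-‿distribˡ-* _ _) ⟩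
      - (- (suc m ×ₘ 1#) * suc n ×ₘ 1#)  ≈⟨ -‿distribʳ-* _ _ ⟩
      - (suc m ×ₘ 1#) * - (suc n ×ₘ 1#)  ∎

  fromℤ-morphism : ACR._-Raw-AlmostCommutative⟶_ ℤ.+-*-rawRing (ACR.fromCommutativeRing commutativeRing)
  fromℤ-morphism = record
    { ⟦_⟧ = fromℤ ; +-homo = fromℤ-+ ; *-homo = fromℤ-* ; -‿homo = fromℤ-neg
    ; 0-homo = refl ; 1-homo = +-identityʳ 1# }

  fromℤ-≟ : ∀ x y → Maybe (fromℤ x ≈ fromℤ y)
  fromℤ-≟ x y with x ℤ.≟ y
  ... | yes ≡.refl = just refl
  ... | no  _      = nothing

  open import Algebra.Solver.Ring ℤ.+-*-rawRing (ACR.fromCommutativeRing commutativeRing) fromℤ-morphism fromℤ-≟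
    using (solve; _:=_; _:+_; _:*_; _:-_; :-_; con)

  open IsTotalOrder isTotalOrder using (total; antisym; ≲-respˡ-≈; ≲-respʳ-≈)
    renaming (trans to ≤-trans; refl to ≤-refl)

  abstract
    ≤-resp₂ : ∀ {a b a′ b′} → a ≈ a′ → b ≈ b′ → a ≤ b → a′ ≤ b′
    ≤-resp₂ a≈a′ b≈b′ a≤b = ≲-respʳ-≈ b≈b′ (≲-respˡ-≈ a≈a′ a≤b)

    <-resp₂ : ∀ {a b a′ b′} → a ≈ a′ → b ≈ b′ → a < b → a′ < b′
    <-resp₂ a≈a′ b≈b′ (a≤b , a≉b) = ≤-resp₂ a≈a′ b≈b′ a≤b , λ e → a≉b (trans a≈a′ (trans e (sym b≈b′)))

    -‿antitone : ∀ {x y} → x ≤ y → (- y) ≤ (- x)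
    -‿antitone {x} {y} x≤y = ≤-resp₂ (solve 2 (λ x y → x :+ (:- x :+ :- y) := :- y) refl x y)
                                     (solve 2 (λ x y → y :+ (:- x :+ :- y) := :- x) refl x y)
                                     (+-mono-≤ (- x - y) x≤y)

    x≤0⇒0≤-x : ∀ {x} → x ≤ 0# → 0# ≤ (- x)
    x≤0⇒0≤-x x≤0 = ≤-resp₂ -0#≈0# refl (-‿antitone x≤0)

    0≤x*x : ∀ x → 0# ≤ (x * x)
    0≤x*x x with total 0# x
    ... | inj₁ 0≤x = *-nonneg 0≤x 0≤x
    ... | inj₂ x≤0 = ≤-resp₂ refl (solve 1 (λ x → :- x :* :- x := x :* x) refl x)
                             (*-nonneg (x≤0⇒0≤-x x≤0) (x≤0⇒0≤-x x≤0))

    0≤1 : 0# ≤ 1#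
    0≤1 = ≤-resp₂ refl (*-identityʳ 1#) (0≤x*x 1#)

    0<x⇒x≉0 : ∀ {x} → 0# < x → ¬ x ≈ 0#
    0<x⇒x≉0 (_ , 0≉x) x≈0 = 0≉x (sym x≈0)

    x<0⇒x≉0 : ∀ {x} → x < 0# → ¬ x ≈ 0#
    x<0⇒x≉0 = proj₂

    0<x⇒x≮0 : ∀ {x} → 0# < x → ¬ x < 0#
    0<x⇒x≮0 (0≤x , _) (x≤0 , x≉0) = x≉0 (antisym x≤0 0≤x)

    x≉0⇒0<x⊎x<0 : ∀ {x} → ¬ x ≈ 0# → (0# < x) ⊎ (x < 0#)
    x≉0⇒0<x⊎x<0 {x} x≉0 with total 0# x
    ... | inj₁ 0≤x = inj₁ (0≤x , λ e → x≉0 (sym e))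
    ... | inj₂ x≤0 = inj₂ (x≤0 , x≉0)

    neg⇒-‿pos : ∀ {x} → x < 0# → 0# < (- x)
    neg⇒-‿pos (x≤0 , x≉0) = x≤0⇒0≤-x x≤0 , λ e → x≉0 (trans (sym (-‿involutive _)) (trans (-‿cong (sym e)) -0#≈0#))

    -‿pos⇒neg : ∀ {x} → 0# < (- x) → x < 0#
    -‿pos⇒neg {x} (0≤-x , 0≉-x) =
      ≤-resp₂ (-‿involutive x) -0#≈0# (-‿antitone 0≤-x) ,
      λ e → 0≉-x (sym (trans (-‿cong e) -0#≈0#))

    x*y≈0⇒y≈0 : ∀ {x y} → ¬ x ≈ 0# → x * y ≈ 0# → y ≈ 0#
    x*y≈0⇒y≈0 {x} {y} x≉0 xy≈0 with inverse x x≉0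
    ... | x⁻¹ , xx⁻¹≈1 = begin
      y                ≈⟨ *-identityˡ y ⟨
      1# * y           ≈⟨ *-congʳ (trans (*-comm x⁻¹ x) xx⁻¹≈1) ⟨
      (x⁻¹ * x) * y    ≈⟨ *-assoc x⁻¹ x y ⟩
      x⁻¹ * (x * y)    ≈⟨ *-congˡ xy≈0 ⟩
      x⁻¹ * 0#         ≈⟨ zeroʳ x⁻¹ ⟩
      0#               ∎

    x≉0∧y≉0⇒x*y≉0 : ∀ {x y} → ¬ x ≈ 0# → ¬ y ≈ 0# → ¬ x * y ≈ 0#
    x≉0∧y≉0⇒x*y≉0 x≉0 y≉0 xy≈0 = y≉0 (x*y≈0⇒y≈0 x≉0 xy≈0)

    x≈-x⇒x≈0 : ∀ {x} → x ≈ - x → x ≈ 0#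
    x≈-x⇒x≈0 {x} x≈-x = x*y≈0⇒y≈0 1+1≉0 (begin
      (1# + 1#) * x  ≈⟨ distribʳ x 1# 1# ⟩
      1# * x + 1# * x ≈⟨ +-cong (*-identityˡ x) (*-identityˡ x) ⟩
      x + x          ≈⟨ +-congˡ x≈-x ⟩
      x - x          ≈⟨ -‿inverseʳ x ⟩
      0#             ∎)
      where
      1+1≉0 : ¬ 1# + 1# ≈ 0#
      1+1≉0 e = 0≉1 (antisym 0≤1 (≤-resp₂ (+-identityˡ 1#) e (+-mono-≤ 1# 0≤1)))

    *-pos-pos : ∀ {x y} → 0# < x → 0# < y → 0# < (x * y)
    *-pos-pos 0<x 0<y = *-nonneg (proj₁ 0<x) (proj₁ 0<y) ,
                        λ e → x≉0∧y≉0⇒x*y≉0 (0<x⇒x≉0 0<x) (0<x⇒x≉0 0<y) (sym e)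

    *-pos-neg : ∀ {x y} → 0# < x → y < 0# → (x * y) < 0#
    *-pos-neg {x} {y} 0<x y<0 = -‿pos⇒neg (<-resp₂ refl (sym (-‿distribʳ-* x y)) (*-pos-pos 0<x (neg⇒-‿pos y<0)))

    *-neg-pos : ∀ {x y} → x < 0# → 0# < y → (x * y) < 0#
    *-neg-pos {x} {y} x<0 0<y = <-resp₂ (*-comm y x) refl (*-pos-neg 0<y x<0)

    *-neg-neg : ∀ {x y} → x < 0# → y < 0# → 0# < (x * y)
    *-neg-neg {x} {y} x<0 y<0 =
      <-resp₂ refl (solve 2 (λ x y → :- x :* :- y := x :* y) refl x y) (*-pos-pos (neg⇒-‿pos x<0) (neg⇒-‿pos y<0))

  FlipTogether : Carrier → Carrier → Carrier → Carrier → Set (ℓ₁ ⊔ ℓ₂)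
  FlipTogether u ũ u′ ũ′ = (SameSign u ũ × SameSign u′ ũ′) ⊎ (OppositeSign u ũ × OppositeSign u′ ũ′)

  abstract
    sameSign-sym : ∀ {a b} → SameSign a b → SameSign b a
    sameSign-sym (inj₁ (0<a , 0<b)) = inj₁ (0<b , 0<a)
    sameSign-sym (inj₂ (a<0 , b<0)) = inj₂ (b<0 , a<0)

    oppositeSign-sym : ∀ {a b} → OppositeSign a b → OppositeSign b a
    oppositeSign-sym (inj₁ (0<a , b<0)) = inj₂ (b<0 , 0<a)
    oppositeSign-sym (inj₂ (a<0 , 0<b)) = inj₁ (0<b , a<0)

    sameSign-trans : ∀ {a b c} → SameSign a b → SameSign b c → SameSign a c
    sameSign-trans (inj₁ (0<a , _))   (inj₁ (_ , 0<c))   = inj₁ (0<a , 0<c)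
    sameSign-trans (inj₁ (_ , 0<b))   (inj₂ (b<0 , _))   = ⊥-elim (0<x⇒x≮0 0<b b<0)
    sameSign-trans (inj₂ (_ , b<0))   (inj₁ (0<b , _))   = ⊥-elim (0<x⇒x≮0 0<b b<0)
    sameSign-trans (inj₂ (a<0 , _))   (inj₂ (_ , c<0))   = inj₂ (a<0 , c<0)

    opposite-same⇒opposite : ∀ {a b c} → OppositeSign a b → SameSign b c → OppositeSign a c
    opposite-same⇒opposite (inj₁ (_ , b<0))   (inj₁ (0<b , _))   = ⊥-elim (0<x⇒x≮0 0<b b<0)
    opposite-same⇒opposite (inj₁ (0<a , _))   (inj₂ (_ , c<0))   = inj₁ (0<a , c<0)
    opposite-same⇒opposite (inj₂ (a<0 , _))   (inj₁ (_ , 0<c))   = inj₂ (a<0 , 0<c)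
    opposite-same⇒opposite (inj₂ (_ , 0<b))   (inj₂ (b<0 , _))   = ⊥-elim (0<x⇒x≮0 0<b b<0)

    opposite-opposite⇒same : ∀ {a b c} → OppositeSign a b → OppositeSign b c → SameSign a c
    opposite-opposite⇒same (inj₁ (_ , b<0))   (inj₁ (0<b , _))   = ⊥-elim (0<x⇒x≮0 0<b b<0)
    opposite-opposite⇒same (inj₁ (0<a , _))   (inj₂ (_ , 0<c))   = inj₁ (0<a , 0<c)
    opposite-opposite⇒same (inj₂ (a<0 , _))   (inj₁ (_ , c<0))   = inj₂ (a<0 , c<0)
    opposite-opposite⇒same (inj₂ (_ , 0<b))   (inj₂ (b<0 , _))   = ⊥-elim (0<x⇒x≮0 0<b b<0)

    same∧opposite⇒⊥ : ∀ {a b} → SameSign a b → OppositeSign a b → ⊥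
    same∧opposite⇒⊥ ss os with sameSign-trans (sameSign-sym ss) ss | opposite-same⇒opposite (oppositeSign-sym os) ss
    ... | _ | inj₁ (0<b , b<0) = 0<x⇒x≮0 0<b b<0
    ... | _ | inj₂ (b<0 , 0<b) = 0<x⇒x≮0 0<b b<0

    sameSign⊎oppositeSign : ∀ {a b} → ¬ a ≈ 0# → ¬ b ≈ 0# → SameSign a b ⊎ OppositeSign a b
    sameSign⊎oppositeSign a≉0 b≉0 with x≉0⇒0<x⊎x<0 a≉0 | x≉0⇒0<x⊎x<0 b≉0
    ... | inj₁ 0<a | inj₁ 0<b = inj₁ (inj₁ (0<a , 0<b))
    ... | inj₁ 0<a | inj₂ b<0 = inj₂ (inj₁ (0<a , b<0))
    ... | inj₂ a<0 | inj₁ 0<b = inj₂ (inj₂ (a<0 , 0<b))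
    ... | inj₂ a<0 | inj₂ b<0 = inj₁ (inj₂ (a<0 , b<0))

    oppositeSign⇒≉0 : ∀ {a b} → OppositeSign a b → ¬ a ≈ 0#
    oppositeSign⇒≉0 (inj₁ (0<a , _)) = 0<x⇒x≉0 0<a
    oppositeSign⇒≉0 (inj₂ (a<0 , _)) = x<0⇒x≉0 a<0

    sameSign-resp₂ : ∀ {a b a′ b′} → a ≈ a′ → b ≈ b′ → SameSign a b → SameSign a′ b′
    sameSign-resp₂ a≈a′ b≈b′ (inj₁ (0<a , 0<b)) = inj₁ (<-resp₂ refl a≈a′ 0<a , <-resp₂ refl b≈b′ 0<b)
    sameSign-resp₂ a≈a′ b≈b′ (inj₂ (a<0 , b<0)) = inj₂ (<-resp₂ a≈a′ refl a<0 , <-resp₂ b≈b′ refl b<0)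

    oppositeSign-resp₂ : ∀ {a b a′ b′} → a ≈ a′ → b ≈ b′ → OppositeSign a b → OppositeSign a′ b′
    oppositeSign-resp₂ a≈a′ b≈b′ (inj₁ (0<a , b<0)) = inj₁ (<-resp₂ refl a≈a′ 0<a , <-resp₂ b≈b′ refl b<0)
    oppositeSign-resp₂ a≈a′ b≈b′ (inj₂ (a<0 , 0<b)) = inj₂ (<-resp₂ a≈a′ refl a<0 , <-resp₂ refl b≈b′ 0<b)

    sameSign-pos* : ∀ {t κ} → 0# < t → ¬ t * κ ≈ 0# → SameSign (t * κ) κ
    sameSign-pos* 0<t tκ≉0 with x≉0⇒0<x⊎x<0 (λ κ≈0 → tκ≉0 (trans (*-congˡ κ≈0) (zeroʳ _)))
    ... | inj₁ 0<κ = inj₁ (*-pos-pos 0<t 0<κ , 0<κ)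
    ... | inj₂ κ<0 = inj₂ (*-pos-neg 0<t κ<0 , κ<0)

    sameSign⇒≉0 : ∀ {a b} → SameSign a b → ¬ a ≈ 0#
    sameSign⇒≉0 (inj₁ (0<a , _)) = 0<x⇒x≉0 0<a
    sameSign⇒≉0 (inj₂ (a<0 , _)) = x<0⇒x≉0 a<0

    sameSign-*⇒pos : ∀ {s κ} → SameSign (s * κ) κ → 0# < s
    sameSign-*⇒pos {s} {κ} ss with x≉0⇒0<x⊎x<0 (λ s≈0 → sameSign⇒≉0 ss (trans (*-congʳ s≈0) (zeroˡ κ))) | ss
    ... | inj₁ 0<s | _                  = 0<s
    ... | inj₂ s<0 | inj₁ (0<sκ , 0<κ) = ⊥-elim (0<x⇒x≮0 0<sκ (*-neg-pos s<0 0<κ))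
    ... | inj₂ s<0 | inj₂ (sκ<0 , κ<0) = ⊥-elim (0<x⇒x≮0 (*-neg-neg s<0 κ<0) sκ<0)

  flipTogether-swap : ∀ {u ũ u′ ũ′} → FlipTogether u ũ u′ ũ′ → FlipTogether u′ ũ′ u ũ
  flipTogether-swap (inj₁ (ss , ss′)) = inj₁ (ss′ , ss)
  flipTogether-swap (inj₂ (os , os′)) = inj₂ (os′ , os)

  sameSign-transfer : ∀ {u ũ u′ ũ′ κ κ′} → FlipTogether u ũ u′ ũ′ → ¬ κ′ ≈ 0# →
    SameSign u κ ⇔ SameSign u′ κ′ → SameSign ũ κ → SameSign ũ′ κ′
  sameSign-transfer (inj₁ (ss , ss′)) _ same ũκ =
    sameSign-trans (sameSign-sym ss′) (Equivalence.to same (sameSign-trans ss ũκ))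
  sameSign-transfer (inj₂ (os , os′)) κ′≉0 same ũκ with sameSign⊎oppositeSign (oppositeSign⇒≉0 os′) κ′≉0
  ... | inj₁ u′κ′ = ⊥-elim (same∧opposite⇒⊥ (Equivalence.from same u′κ′) (opposite-same⇒opposite os ũκ))
  ... | inj₂ u′κ′ = opposite-opposite⇒same (oppositeSign-sym os′) u′κ′

  sameSign-transfer⇔ : ∀ {u ũ u′ ũ′ κ κ′} → FlipTogether u ũ u′ ũ′ → ¬ κ ≈ 0# → ¬ κ′ ≈ 0# →
    SameSign u κ ⇔ SameSign u′ κ′ → SameSign ũ κ ⇔ SameSign ũ′ κ′
  sameSign-transfer⇔ flip κ≉0 κ′≉0 same =
    mk⇔ (sameSign-transfer flip κ′≉0 same) (sameSign-transfer (flipTogether-swap flip) κ≉0 (⇔.sym same))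

  abstract
    sumFin-cong : ∀ {k} {f g : Fin k → Carrier} → (∀ i → f i ≈ g i) → sumFin f ≈ sumFin g
    sumFin-cong {zero}  f≈g = refl
    sumFin-cong {suc k} f≈g = +-cong (f≈g zero) (sumFin-cong (λ i → f≈g (suc i)))

    sumFin-distrib-+ : ∀ {k} (f g : Fin k → Carrier) → sumFin (λ i → f i + g i) ≈ sumFin f + sumFin g
    sumFin-distrib-+ {zero}  f g = sym (+-identityˡ 0#)
    sumFin-distrib-+ {suc k} f g =
      trans (+-congˡ (sumFin-distrib-+ (λ i → f (suc i)) (λ i → g (suc i))))
            (solve 4 (λ a b x y → (a :+ b) :+ (x :+ y) := (a :+ x) :+ (b :+ y)) refl (f zero) (g zero) _ _)

    *-distribˡ-sumFin : ∀ {k} a (f : Fin k → Carrier) → a * sumFin f ≈ sumFin (λ i → a * f i)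
    *-distribˡ-sumFin {zero}  a f = zeroʳ a
    *-distribˡ-sumFin {suc k} a f = trans (distribˡ a _ _) (+-congˡ (*-distribˡ-sumFin a (λ i → f (suc i))))

    sumFin-≈0 : ∀ {k} {f : Fin k → Carrier} → (∀ i → f i ≈ 0#) → sumFin f ≈ 0#
    sumFin-≈0 {zero}  f≈0 = refl
    sumFin-≈0 {suc k} f≈0 = trans (+-cong (f≈0 zero) (sumFin-≈0 (λ i → f≈0 (suc i)))) (+-identityˡ 0#)

    sumFin-neg : ∀ {k} (f : Fin k → Carrier) → sumFin (λ i → - f i) ≈ - sumFin f
    sumFin-neg {zero}  f = sym -0#≈0#
    sumFin-neg {suc k} f = trans (+-congˡ (sumFin-neg (λ i → f (suc i)))) (-‿+-comm _ _)

    sumFin-comm : ∀ {k l} (f : Fin k → Fin l → Carrier) →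
      sumFin (λ i → sumFin (λ j → f i j)) ≈ sumFin (λ j → sumFin (λ i → f i j))
    sumFin-comm {zero} {l} f = sym (sumFin-≈0 {l} (λ j → refl))
    sumFin-comm {suc k} f =
      trans (+-congˡ (sumFin-comm (λ i j → f (suc i) j))) (sym (sumFin-distrib-+ (f zero) _))

    sumFin-nonneg : ∀ {k} {f : Fin k → Carrier} → (∀ i → 0# ≤ f i) → 0# ≤ sumFin f
    sumFin-nonneg {zero}  0≤f = ≤-refl
    sumFin-nonneg {suc k} {f} 0≤f =
      ≤-trans (0≤f zero) (≤-resp₂ (+-identityʳ _) (+-comm _ _)
                                  (≤-resp₂ (+-comm _ _) refl (+-mono-≤ (f zero) (sumFin-nonneg (λ i → 0≤f (suc i))))))

    nonneg+nonneg≈0 : ∀ {a b} → 0# ≤ a → 0# ≤ b → a + b ≈ 0# → a ≈ 0# × b ≈ 0#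
    nonneg+nonneg≈0 {a} {b} 0≤a 0≤b a+b≈0 =
      antisym (≤-resp₂ (+-identityʳ a) a+b≈0 (≤-resp₂ (+-comm _ _) (+-comm _ _) (+-mono-≤ a 0≤b))) 0≤a ,
      antisym (≤-resp₂ (+-identityˡ b) a+b≈0 (+-mono-≤ b 0≤a)) 0≤b

    sumFin-squares≈0 : ∀ {k} (f : Fin k → Carrier) → sumFin (λ i → f i * f i) ≈ 0# → ¬ ¬ (∀ i → f i ≈ 0#)
    sumFin-squares≈0 {zero} f _ ¬all = ¬all (λ ())
    sumFin-squares≈0 {suc k} f Σ≈0 ¬all
      with nonneg+nonneg≈0 (0≤x*x (f zero)) (sumFin-nonneg (λ i → 0≤x*x (f (suc i)))) Σ≈0
    ... | f₀²≈0 , rest≈0 =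
      sumFin-squares≈0 (λ i → f (suc i)) rest≈0 λ tail≈0 →
        let f₀≉0 : ¬ f zero ≈ 0#
            f₀≉0 f₀≈0 = ¬all λ { zero → f₀≈0 ; (suc i) → tail≈0 i }
        in x≉0∧y≉0⇒x*y≉0 f₀≉0 f₀≉0 f₀²≈0

  -- Determinants

  Matrix : ℕ → Set c
  Matrix k = Fin k → Fin k → Carrier

  minor : ∀ {k} → Matrix (suc k) → Fin (suc k) → Matrix k
  minor M i r s = M (punchIn i r) (suc s)

  laplaceTerm : ∀ {k} → Matrix (suc k) → Fin (suc k) → Carrier
  laplaceTerm M i = sgnFin i * (M i zero * det (minor M i))

  abstract
    det-cong : ∀ {k} {M N : Matrix k} → (∀ r s → M r s ≈ N r s) → det M ≈ det N
    det-cong {zero}  M≈N = refl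
    det-cong {suc k} {M} {N} M≈N =
      sumFin-cong {f = laplaceTerm M} {laplaceTerm N} (λ i → *-congˡ (*-cong (M≈N i zero) (det-cong (λ r s → M≈N (punchIn i r) (suc s)))))

    laplaceTerm-≈0 : ∀ {k} (M : Matrix (suc k)) i → det (minor M i) ≈ 0# → laplaceTerm M i ≈ 0#
    laplaceTerm-≈0 M i minor≈0 = trans (*-congˡ (trans (*-congˡ minor≈0) (zeroʳ _))) (zeroʳ _)

    det-linearInColumn : ∀ {k} (M M₁ M₂ : Matrix (suc k)) (c : Fin (suc k)) (α β : Carrier) →
      (∀ r s → s ≢ c → M₁ r s ≈ M r s) → (∀ r s → s ≢ c → M₂ r s ≈ M r s) →
      (∀ r → M r c ≈ α * M₁ r c + β * M₂ r c) → det M ≈ α * det M₁ + β * det M₂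
    laplaceTerm-linearInColumn : ∀ {k} (M M₁ M₂ : Matrix (suc k)) (c : Fin (suc k)) (α β : Carrier) →
      (∀ r s → s ≢ c → M₁ r s ≈ M r s) → (∀ r s → s ≢ c → M₂ r s ≈ M r s) →
      (∀ r → M r c ≈ α * M₁ r c + β * M₂ r c) →
      ∀ i → laplaceTerm M i ≈ α * laplaceTerm M₁ i + β * laplaceTerm M₂ i

    det-linearInColumn M M₁ M₂ c α β M₁≈M M₂≈M Mc = begin
      sumFin (laplaceTerm M)
        ≈⟨ sumFin-cong (laplaceTerm-linearInColumn M M₁ M₂ c α β M₁≈M M₂≈M Mc) ⟩
      sumFin (λ i → α * laplaceTerm M₁ i + β * laplaceTerm M₂ i)
        ≈⟨ sumFin-distrib-+ (λ i → α * laplaceTerm M₁ i) (λ i → β * laplaceTerm M₂ i) ⟩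
      sumFin (λ i → α * laplaceTerm M₁ i) + sumFin (λ i → β * laplaceTerm M₂ i)
        ≈⟨ +-cong (*-distribˡ-sumFin α (laplaceTerm M₁)) (*-distribˡ-sumFin β (laplaceTerm M₂)) ⟨
      α * det M₁ + β * det M₂
        ∎

    laplaceTerm-linearInColumn M M₁ M₂ zero α β M₁≈M M₂≈M Mc i = begin
      sgnFin i * (M i zero * det (minor M i))
        ≈⟨ *-congˡ (*-congʳ (Mc i)) ⟩
      sgnFin i * ((α * M₁ i zero + β * M₂ i zero) * det (minor M i))
        ≈⟨ solve 6 (λ s a x b y d → s :* ((a :* x :+ b :* y) :* d) := a :* (s :* (x :* d)) :+ b :* (s :* (y :* d)))
                   refl (sgnFin i) α (M₁ i zero) β (M₂ i zero) (det (minor M i)) ⟩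
      α * (sgnFin i * (M₁ i zero * det (minor M i))) + β * (sgnFin i * (M₂ i zero * det (minor M i)))
        ≈⟨ +-cong (*-congˡ (*-congˡ (*-congˡ (det-cong (λ r s → sym (M₁≈M (punchIn i r) (suc s) λ ()))))))
                  (*-congˡ (*-congˡ (*-congˡ (det-cong (λ r s → sym (M₂≈M (punchIn i r) (suc s) λ ())))))) ⟩
      α * laplaceTerm M₁ i + β * laplaceTerm M₂ i
        ∎
    laplaceTerm-linearInColumn {suc k} M M₁ M₂ (suc c) α β M₁≈M M₂≈M Mc i = begin
      sgnFin i * (M i zero * det (minor M i))
        ≈⟨ *-congˡ (*-congˡ (det-linearInColumn (minor M i) (minor M₁ i) (minor M₂ i) c α β
                               (λ r s s≢c → M₁≈M (punchIn i r) (suc s) (λ e → s≢c (Finₚ.suc-injective e)))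
                               (λ r s s≢c → M₂≈M (punchIn i r) (suc s) (λ e → s≢c (Finₚ.suc-injective e)))
                               (λ r → Mc (punchIn i r)))) ⟩
      sgnFin i * (M i zero * (α * det (minor M₁ i) + β * det (minor M₂ i)))
        ≈⟨ solve 6 (λ s m a x b y → s :* (m :* (a :* x :+ b :* y)) := a :* (s :* (m :* x)) :+ b :* (s :* (m :* y)))
                   refl (sgnFin i) (M i zero) α (det (minor M₁ i)) β (det (minor M₂ i)) ⟩
      α * (sgnFin i * (M i zero * det (minor M₁ i))) + β * (sgnFin i * (M i zero * det (minor M₂ i)))
        ≈⟨ +-cong (*-congˡ (*-congˡ (*-congʳ (sym (M₁≈M i zero λ ())))))
                  (*-congˡ (*-congˡ (*-congʳ (sym (M₂≈M i zero λ ()))))) ⟩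
      α * laplaceTerm M₁ i + β * laplaceTerm M₂ i
        ∎

  RowCongruent : ∀ {k n} → ((Fin k → Fin n) → Carrier) → Set ℓ₁
  RowCongruent D = ∀ ρ ρ′ → (∀ a → ρ a ≡ ρ′ a) → D ρ ≈ D ρ′

  -- Expansion of a determinant along its first two columns z and y;
  -- D ρ stands for the minor on the rows ρ and the remaining columns.
  expand₂ : ∀ {k} (z y : Fin (suc (suc k)) → Carrier) → ((Fin k → Fin (suc (suc k))) → Carrier) → Carrier
  expand₂ z y D = sumFin (λ i → sgnFin i * (z i * sumFin (λ r → sgnFin r * (y (punchIn i r) * D (λ a → punchIn i (punchIn r a))))))

  expandBelowTop : ∀ {k} (y : Fin (suc (suc k)) → Carrier) → ((Fin k → Fin (suc (suc k))) → Carrier) → Carrier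
  expandBelowTop y D = sumFin (λ r → sgnFin r * (y (suc r) * D (λ a → suc (punchIn r a))))

  innerBelowTop : ∀ {k} (y : Fin (suc (suc k)) → Carrier) → ((Fin k → Fin (suc (suc k))) → Carrier) → Fin (suc k) → Carrier
  innerBelowTop y D i = sumFin (λ r → sgnFin r * (y (suc (punchIn i r)) * D (λ a → punchIn (suc i) (punchIn (suc r) a))))

  expand₂BelowTop : ∀ {k} (z y : Fin (suc (suc k)) → Carrier) → ((Fin k → Fin (suc (suc k))) → Carrier) → Carrier
  expand₂BelowTop z y D = sumFin (λ i → sgnFin i * (z (suc i) * innerBelowTop y D i))

  abstract
    expand₂-splitTop : ∀ {k} z y (D : (Fin k → Fin (suc (suc k))) → Carrier) →
      expand₂ z y D ≈ z zero * expandBelowTop y D + (- (y zero * expandBelowTop z D) + expand₂BelowTop z y D)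
    expand₂-splitTop {k} z y D = +-cong (*-identityˡ _) (begin
      sumFin (λ i → (- sgnFin i) * (z (suc i) * (1# * (y zero * E i) + negatedInner i)))
        ≈⟨ sumFin-cong rowTerm ⟩
      sumFin (λ i → - (y zero * topTerm i) + sgnFin i * (z (suc i) * innerBelowTop y D i))
        ≈⟨ sumFin-distrib-+ (λ i → - (y zero * topTerm i)) (λ i → sgnFin i * (z (suc i) * innerBelowTop y D i)) ⟩
      sumFin (λ i → - (y zero * topTerm i)) + expand₂BelowTop z y D
        ≈⟨ +-congʳ (trans (sumFin-neg (λ i → y zero * topTerm i)) (-‿cong (sym (*-distribˡ-sumFin (y zero) topTerm)))) ⟩
      - (y zero * expandBelowTop z D) + expand₂BelowTop z y D
        ∎)
      where
      E : Fin (suc k) → Carrier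
      E i = D (λ a → suc (punchIn i a))
      topTerm : Fin (suc k) → Carrier
      topTerm i = sgnFin i * (z (suc i) * E i)
      innerTerm : Fin (suc k) → Fin k → Carrier
      innerTerm i r = sgnFin r * (y (suc (punchIn i r)) * D (λ a → punchIn (suc i) (punchIn (suc r) a)))
      negatedInner : Fin (suc k) → Carrier
      negatedInner i = sumFin (λ r → (- sgnFin r) * (y (suc (punchIn i r)) * D (λ a → punchIn (suc i) (punchIn (suc r) a))))
      negatedInner≈ : ∀ i → negatedInner i ≈ - innerBelowTop y D i
      negatedInner≈ i = trans (sumFin-cong {g = λ r → - innerTerm i r} (λ r → sym (-‿distribˡ-* _ _))) (sumFin-neg (innerTerm i))
      rowTerm : ∀ i → (- sgnFin i) * (z (suc i) * (1# * (y zero * E i) + negatedInner i))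
                    ≈ - (y zero * topTerm i) + sgnFin i * (z (suc i) * innerBelowTop y D i)
      rowTerm i = trans (*-congˡ (*-congˡ (+-cong (*-identityˡ _) (negatedInner≈ i))))
        (solve 5 (λ s z₁ y₀ e q → (:- s) :* (z₁ :* (y₀ :* e :+ :- q)) := :- (y₀ :* (s :* (z₁ :* e))) :+ s :* (z₁ :* q))
               refl (sgnFin i) (z (suc i)) (y zero) (E i) (innerBelowTop y D i))

    expand₂BelowTop-zero : ∀ z y (D : (Fin zero → Fin 2) → Carrier) → expand₂BelowTop {zero} z y D ≈ 0#
    expand₂BelowTop-zero z y D = trans (+-identityʳ _) (trans (*-identityˡ _) (zeroʳ (z (suc zero))))

    expand₂BelowTop≈expand₂ : ∀ {k} z y (D : (Fin (suc k) → Fin (suc (suc (suc k)))) → Carrier) → RowCongruent D →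
      expand₂BelowTop z y D ≈ expand₂ (λ i → z (suc i)) (λ i → y (suc i)) (λ ρ → D (Fin.lift 1 ρ))
    expand₂BelowTop≈expand₂ {k} z y D D-cong = sumFin-cong row
      where
      liftedInner : Fin (suc (suc k)) → Carrier
      liftedInner i = sumFin (λ r → sgnFin r * (y (suc (punchIn i r)) * D (Fin.lift 1 (λ a → punchIn i (punchIn r a)))))
      inner≈ : ∀ i → innerBelowTop y D i ≈ liftedInner i
      inner≈ i = sumFin-cong {f = λ r → sgnFin r * (y (suc (punchIn i r)) * D (λ a → punchIn (suc i) (punchIn (suc r) a)))}
                   (λ r → *-congˡ (*-congˡ (D-cong _ (Fin.lift 1 (λ a → punchIn i (punchIn r a))) λ { zero → ≡.refl ; (suc a) → ≡.refl })))
      row : ∀ i → sgnFin i * (z (suc i) * innerBelowTop y D i) ≈ sgnFin i * (z (suc i) * liftedInner i)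
      row i = *-congˡ (*-congˡ (inner≈ i))

    RowCongruent-lift : ∀ {k n} (D : (Fin (suc k) → Fin (suc n)) → Carrier) → RowCongruent D →
      RowCongruent (λ ρ → D (Fin.lift 1 ρ))
    RowCongruent-lift D D-cong ρ ρ′ ρ≗ρ′ = D-cong _ _ λ { zero → ≡.refl ; (suc a) → ≡.cong suc (ρ≗ρ′ a) }

    expand₂-antisym : ∀ {k} z y (D : (Fin k → Fin (suc (suc k))) → Carrier) → RowCongruent D →
      expand₂ z y D ≈ - expand₂ y z D
    expand₂-antisym z y D D-cong = begin
      expand₂ z y D
        ≈⟨ expand₂-splitTop z y D ⟩
      z zero * expandBelowTop y D + (- (y zero * expandBelowTop z D) + expand₂BelowTop z y D)
        ≈⟨ +-congˡ (+-congˡ (expand₂BelowTop-antisym z y D D-cong)) ⟩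
      z zero * expandBelowTop y D + (- (y zero * expandBelowTop z D) + - expand₂BelowTop y z D)
        ≈⟨ solve 5 (λ z₀ a y₀ b t → z₀ :* a :+ (:- (y₀ :* b) :+ :- t) := :- (y₀ :* b :+ (:- (z₀ :* a) :+ t)))
                   refl (z zero) (expandBelowTop y D) (y zero) (expandBelowTop z D) (expand₂BelowTop y z D) ⟩
      - (y zero * expandBelowTop z D + (- (z zero * expandBelowTop y D) + expand₂BelowTop y z D))
        ≈⟨ -‿cong (expand₂-splitTop y z D) ⟨
      - expand₂ y z D
        ∎
      where
      expand₂BelowTop-antisym : ∀ {k} z y (D : (Fin k → Fin (suc (suc k))) → Carrier) → RowCongruent D →
        expand₂BelowTop z y D ≈ - expand₂BelowTop y z D
      expand₂BelowTop-antisym {zero} z y D _ =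
        trans (expand₂BelowTop-zero z y D) (trans (sym -0#≈0#) (-‿cong (sym (expand₂BelowTop-zero y z D))))
      expand₂BelowTop-antisym {suc k} z y D D-cong = begin
        expand₂BelowTop z y D
          ≈⟨ expand₂BelowTop≈expand₂ z y D D-cong ⟩
        expand₂ (λ i → z (suc i)) (λ i → y (suc i)) (λ ρ → D (Fin.lift 1 ρ))
          ≈⟨ expand₂-antisym (λ i → z (suc i)) (λ i → y (suc i)) _ (RowCongruent-lift D D-cong) ⟩
        - expand₂ (λ i → y (suc i)) (λ i → z (suc i)) (λ ρ → D (Fin.lift 1 ρ))
          ≈⟨ -‿cong (expand₂BelowTop≈expand₂ y z D D-cong) ⟨
        - expand₂BelowTop y z D
          ∎

  swapFirstColumns : ∀ {k} → Matrix (suc (suc k)) → Matrix (suc (suc k))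
  swapFirstColumns M r zero          = M r (suc zero)
  swapFirstColumns M r (suc zero)    = M r zero
  swapFirstColumns M r (suc (suc s)) = M r (suc (suc s))

  abstract
    -- Unfolding det twice turns both sides into expand₂ on the first two columns.
    det-swapFirstColumns : ∀ {k} (M : Matrix (suc (suc k))) → det (swapFirstColumns M) ≈ - det M
    det-swapFirstColumns M = expand₂-antisym (λ r → M r (suc zero)) (λ r → M r zero) _
      (λ ρ ρ′ ρ≗ρ′ → det-cong (λ a s → reflexive (≡.cong (λ r → M r (suc (suc s))) (ρ≗ρ′ a))))

    det-equalColumns : ∀ {k} (M : Matrix k) {a b} → a ≢ b → (∀ r → M r a ≈ M r b) → det M ≈ 0#
    det-equalToFirstColumn : ∀ {k} (M : Matrix (suc k)) t → (∀ r → M r zero ≈ M r (suc t)) → det M ≈ 0#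
    det-equalLaterColumns : ∀ {k} (M : Matrix (suc k)) {a b} → a ≢ b → (∀ r → M r (suc a) ≈ M r (suc b)) → det M ≈ 0#

    det-equalColumns M {zero}  {zero}  a≢b _  = ⊥-elim (a≢b ≡.refl)
    det-equalColumns M {zero}  {suc t} _   eq = det-equalToFirstColumn M t eq
    det-equalColumns M {suc t} {zero}  _   eq = det-equalToFirstColumn M t (λ r → sym (eq r))
    det-equalColumns M {suc a} {suc b} a≢b eq = det-equalLaterColumns M (λ e → a≢b (≡.cong suc e)) eq

    det-equalToFirstColumn M zero eq = x≈-x⇒x≈0 (trans (sym (det-cong swap≈M)) (det-swapFirstColumns M))
      where
      swap≈M : ∀ r s → swapFirstColumns M r s ≈ M r s
      swap≈M r zero          = sym (eq r)
      swap≈M r (suc zero)    = eq r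
      swap≈M r (suc (suc s)) = refl
    det-equalToFirstColumn M (suc t) eq = begin
      det M                                ≈⟨ -‿involutive _ ⟨
      - - det M                            ≈⟨ -‿cong (det-swapFirstColumns M) ⟨
      - det (swapFirstColumns M)           ≈⟨ -‿cong (det-equalLaterColumns (swapFirstColumns M) {zero} {suc t} (λ ()) eq) ⟩
      - 0#                                 ≈⟨ -0#≈0# ⟩
      0#                                   ∎

    det-equalLaterColumns M {a} {b} a≢b eq =
      sumFin-≈0 (λ i → laplaceTerm-≈0 M i (det-equalColumns (minor M i) a≢b (λ r → eq (punchIn i r))))

  abstract
    snoc-inject₁ : ∀ {m} (v : Pt m) a (j : Fin m) → snoc v a (inject₁ j) ≡ v j
    snoc-inject₁ {suc m} v a zero    = ≡.refl
    snoc-inject₁ {suc m} v a (suc j) = snoc-inject₁ (λ i → v (suc i)) a j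

    snoc-last : ∀ {m} (v : Pt m) a → snoc v a (fromℕ m) ≡ a
    snoc-last {zero}  v a = ≡.refl
    snoc-last {suc m} v a = snoc-last (λ i → v (suc i)) a

    snoc-notLast : ∀ {m} (v : Pt m) a a′ s → s ≢ fromℕ m → snoc v a s ≡ snoc v a′ s
    snoc-notLast {zero}  v a a′ zero    s≢last = ⊥-elim (s≢last ≡.refl)
    snoc-notLast {suc m} v a a′ zero    s≢last = ≡.refl
    snoc-notLast {suc m} v a a′ (suc s) s≢last = snoc-notLast (λ i → v (suc i)) a a′ s (λ e → s≢last (≡.cong suc e))

  concurrencyMatrix : ∀ {n m} → (Fin n → Pt m) → (Fin (suc m) → Fin n) → Pt n → Matrix (suc m)
  concurrencyMatrix A J y k = snoc (A (J k)) (y (J k))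

  module _ {n m : ℕ} (A : Fin n → Pt m) (J : Fin (suc m) → Fin n) where

    abstract
      concDet-linear : ∀ (y y₁ y₂ : Pt n) α β → (∀ l → y (J l) ≈ α * y₁ (J l) + β * y₂ (J l)) →
        concDet A J y ≈ α * concDet A J y₁ + β * concDet A J y₂
      concDet-linear y y₁ y₂ α β y≈ =
        det-linearInColumn (concurrencyMatrix A J y) (concurrencyMatrix A J y₁) (concurrencyMatrix A J y₂) (fromℕ m) α β
          (λ r s s≢last → reflexive (snoc-notLast (A (J r)) _ _ s s≢last))
          (λ r s s≢last → reflexive (snoc-notLast (A (J r)) _ _ s s≢last))
          (λ r → begin
            snoc (A (J r)) (y (J r)) (fromℕ m)  ≡⟨ snoc-last (A (J r)) (y (J r)) ⟩
            y (J r)                             ≈⟨ y≈ r ⟩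
            α * y₁ (J r) + β * y₂ (J r)         ≡⟨ ≡.cong₂ (λ u v → α * u + β * v) (snoc-last (A (J r)) (y₁ (J r))) (snoc-last (A (J r)) (y₂ (J r))) ⟨
            α * snoc (A (J r)) (y₁ (J r)) (fromℕ m) + β * snoc (A (J r)) (y₂ (J r)) (fromℕ m) ∎)

      concDet-column≈0 : ∀ j → concDet A J (λ i → A i j) ≈ 0#
      concDet-column≈0 j =
        det-equalColumns (concurrencyMatrix A J (λ i → A i j)) Finₚ.fromℕ≢inject₁
          (λ r → reflexive (≡.trans (snoc-last (A (J r)) _) (≡.sym (snoc-inject₁ (A (J r)) _ j))))

      concDet-columnSpace≈0 : ∀ {p} (ι : Fin p → Fin m) (x : Fin p → Carrier) →
        concDet A J (λ i → sumFin (λ l → A i (ι l) * x l)) ≈ 0#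
      concDet-columnSpace≈0 {zero} ι x = begin
        concDet A J (λ _ → 0#)
          ≈⟨ concDet-linear _ _ _ 0# 0# (λ l → sym (trans (+-cong (zeroˡ 0#) (zeroˡ 0#)) (+-identityʳ 0#))) ⟩
        0# * concDet A J (λ _ → 0#) + 0# * concDet A J (λ _ → 0#)
          ≈⟨ trans (+-cong (zeroˡ _) (zeroˡ _)) (+-identityʳ 0#) ⟩
        0# ∎
      concDet-columnSpace≈0 {suc p} ι x = begin
        concDet A J y
          ≈⟨ concDet-linear y (λ i → A i (ι zero)) rest (x zero) 1# (λ l → +-cong (*-comm _ _) (sym (*-identityˡ _))) ⟩
        x zero * concDet A J (λ i → A i (ι zero)) + 1# * concDet A J rest
          ≈⟨ +-cong (*-congˡ (concDet-column≈0 (ι zero))) (*-congˡ (concDet-columnSpace≈0 (λ l → ι (suc l)) (λ l → x (suc l)))) ⟩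
        x zero * 0# + 1# * 0#
          ≈⟨ trans (+-cong (zeroʳ _) (zeroʳ _)) (+-identityʳ 0#) ⟩
        0# ∎
        where
        y rest : Pt n
        y i = sumFin (λ l → A i (ι l) * x l)
        rest i = sumFin (λ l → A i (ι (suc l)) * x (suc l))

  abstract
    concDet-congIndices : ∀ {n m} (A : Fin n → Pt m) {J J′ : Fin (suc m) → Fin n} y → (∀ l → J l ≡ J′ l) →
      concDet A J y ≈ concDet A J′ y
    concDet-congIndices A {J} {J′} y J≗J′ =
      det-cong {M = concurrencyMatrix A J y} {concurrencyMatrix A J′ y}
        (λ r s → reflexive (≡.cong (λ i → snoc (A i) (y i) s) (J≗J′ r)))

  -- Intersections of hyperplanes

  dot : ∀ {m} → Pt m → Pt m → Carrier
  dot a x = sumFin (λ j → a j * x j)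

  Kernel : ∀ {n m r} → (Fin n → Pt m) → (Fin r → Fin n) → Pt m → Set ℓ₁
  Kernel A σ u = ∀ l → dot (A (σ l)) u ≈ 0#

  δ : ∀ {k} → Fin k → Fin k → Carrier
  δ zero    zero    = 1#
  δ zero    (suc _) = 0#
  δ (suc _) zero    = 0#
  δ (suc l) (suc i) = δ l i

  abstract
    dot-cong : ∀ {m} (a : Pt m) {x y : Pt m} → x ≈ᵥ y → dot a x ≈ dot a y
    dot-cong a x≈y = sumFin-cong (λ j → *-congˡ (x≈y j))

    dot-linear : ∀ {m} (a x y : Pt m) s → dot a (λ j → x j + s * y j) ≈ dot a x + s * dot a y
    dot-linear a x y s = begin
      sumFin (λ j → a j * (x j + s * y j))
        ≈⟨ sumFin-cong (λ j → solve 4 (λ a x s y → a :* (x :+ s :* y) := a :* x :+ s :* (a :* y)) refl (a j) (x j) s (y j)) ⟩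
      sumFin (λ j → a j * x j + s * (a j * y j))
        ≈⟨ sumFin-distrib-+ (λ j → a j * x j) _ ⟩
      dot a x + sumFin (λ j → s * (a j * y j))
        ≈⟨ +-congˡ (*-distribˡ-sumFin s (λ j → a j * y j)) ⟨
      dot a x + s * dot a y
        ∎

    dot-difference : ∀ {m} (a x y : Pt m) → dot a (λ j → y j - x j) ≈ dot a y - dot a x
    dot-difference a x y = begin
      sumFin (λ j → a j * (y j - x j))
        ≈⟨ sumFin-cong (λ j → solve 3 (λ a x y → a :* (y :- x) := a :* y :+ :- (a :* x)) refl (a j) (x j) (y j)) ⟩
      sumFin (λ j → a j * y j + - (a j * x j))
        ≈⟨ sumFin-distrib-+ (λ j → a j * y j) _ ⟩
      dot a y + sumFin (λ j → - (a j * x j))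
        ≈⟨ +-congˡ (sumFin-neg (λ j → a j * x j)) ⟩
      dot a y - dot a x
        ∎

    dot-scale : ∀ {m} (a x : Pt m) s → dot a (λ j → s * x j) ≈ s * dot a x
    dot-scale a x s = trans (sumFin-cong (λ j → solve 3 (λ a s x → a :* (s :* x) := s :* (a :* x)) refl (a j) s (x j)))
                        (sym (*-distribˡ-sumFin s (λ j → a j * x j)))

    dot-linearCombination : ∀ {m k} (a : Pt m) (t : Fin k → Carrier) (v : Fin k → Pt m) →
      dot a (λ j → sumFin (λ l → t l * v l j)) ≈ sumFin (λ l → t l * dot a (v l))
    dot-linearCombination {m} {k} a t v = begin
      sumFin (λ j → a j * sumFin (λ l → t l * v l j))
        ≈⟨ sumFin-cong (λ j → *-distribˡ-sumFin (a j) (λ l → t l * v l j)) ⟩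
      sumFin (λ j → sumFin (λ l → a j * (t l * v l j)))
        ≈⟨ sumFin-comm (λ j l → a j * (t l * v l j)) ⟩
      sumFin (λ l → sumFin (λ j → a j * (t l * v l j)))
        ≈⟨ sumFin-cong (λ l → trans (sumFin-cong (λ j → solve 3 (λ a t v → a :* (t :* v) := t :* (a :* v)) refl (a j) (t l) (v l j)))
                                    (sym (*-distribˡ-sumFin (t l) (λ j → a j * v l j)))) ⟩
      sumFin (λ l → t l * dot a (v l))
        ∎

    meet-difference∈Kernel : ∀ {n m r} {A : Fin n → Pt m} {b : Pt n} {σ : Fin r → Fin n} {x y} →
      Meet A b σ x → Meet A b σ y → Kernel A σ (λ j → y j - x j)
    meet-difference∈Kernel {A = A} {σ = σ} {x} {y} x∈ y∈ l =
      trans (dot-difference (A (σ l)) x y) (trans (+-cong (y∈ l) (-‿cong (x∈ l))) (-‿inverseʳ _))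

    sumFin-δ : ∀ {k} (l : Fin k) (f : Fin k → Carrier) → sumFin (λ i → δ l i * f i) ≈ f l
    sumFin-δ {suc k} zero    f = trans (+-cong (*-identityˡ _) (sumFin-≈0 (λ i → zeroˡ (f (suc i))))) (+-identityʳ _)
    sumFin-δ {suc k} (suc l) f = trans (+-cong (zeroˡ _) (sumFin-δ l (λ i → f (suc i)))) (+-identityˡ _)

    δ-diag : ∀ {k} (l : Fin k) → δ l l ≈ 1#
    δ-diag zero    = refl
    δ-diag (suc l) = δ-diag l

    δ-offDiag : ∀ {k} (l i : Fin k) → i ≢ l → δ l i ≈ 0#
    δ-offDiag zero    zero    i≢l = ⊥-elim (i≢l ≡.refl)
    δ-offDiag zero    (suc i) _   = refl
    δ-offDiag (suc l) zero    _   = refl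
    δ-offDiag (suc l) (suc i) i≢l = δ-offDiag l i (λ e → i≢l (≡.cong suc e))

  module AffineMeet {n m r d′} (A : Fin n → Pt m) (b : Pt n) (σ : Fin r → Fin n) (aff : AffineOfDim (Meet A b σ) d′) where

    base : Pt m
    base = proj₁ aff

    direction : Fin d′ → Pt m
    direction = proj₁ (proj₂ aff)

    private
      membership = proj₂ (proj₂ (proj₂ aff))

    abstract
      combination∈ : ∀ (t : Fin d′ → Carrier) → Meet A b σ (λ j → base j + sumFin (λ l → t l * direction l j))
      combination∈ t = proj₂ (membership _) (t , λ j → refl)

      base∈ : Meet A b σ base
      base∈ = proj₂ (membership base) ((λ _ → 0#) , λ j → sym (trans (+-congˡ (sumFin-≈0 (λ l → zeroˡ (direction l j)))) (+-identityʳ _)))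

      ∈⇒combination : ∀ x → Meet A b σ x → ∃ λ (t : Fin d′ → Carrier) → x ≈ᵥ (λ j → base j + sumFin (λ l → t l * direction l j))
      ∈⇒combination x x∈ = proj₁ (membership x) x∈

      kernel⊆span : ∀ u → Kernel A σ u → ∃ λ (t : Fin d′ → Carrier) → u ≈ᵥ (λ j → sumFin (λ l → t l * direction l j))
      kernel⊆span u u∈ker with ∈⇒combination (λ j → base j + 1# * u j) shifted∈
        where
        shifted∈ : Meet A b σ (λ j → base j + 1# * u j)
        shifted∈ l = trans (dot-linear _ base u 1#) (trans (+-cong (base∈ l) (trans (*-congˡ (u∈ker l)) (zeroʳ _))) (+-identityʳ _))
      ... | t , shifted≈ = t , λ j → begin
        u j                                               ≈⟨ solve 2 (λ p u → u := p :+ u :- p) refl (base j) (u j) ⟩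
        (base j + u j) - base j                           ≈⟨ +-congʳ (+-congˡ (*-identityˡ (u j))) ⟨
        (base j + 1# * u j) - base j                      ≈⟨ +-congʳ (shifted≈ j) ⟩
        (base j + sumFin (λ l → t l * direction l j)) - base j ≈⟨ solve 2 (λ p s → p :+ s :- p := s) refl (base j) _ ⟩
        sumFin (λ l → t l * direction l j)                ∎

      direction∈Kernel : ∀ l → Kernel A σ (direction l)
      direction∈Kernel l l′ = trans (dot-cong (A (σ l′)) direction≈) (meet-difference∈Kernel {A = A} {b} {σ} base∈ (combination∈ (δ l)) l′)
        where
        direction≈ : direction l ≈ᵥ (λ j → (base j + sumFin (λ l″ → δ l l″ * direction l″ j)) - base j)
        direction≈ j = sym (trans (+-congʳ (+-congˡ (sumFin-δ l (λ l″ → direction l″ j))))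
                                  (solve 2 (λ p v → p :+ v :- p := v) refl (base j) (direction l j)))

  abstract
    Kernel-linearCombination : ∀ {n m r k} {A : Fin n → Pt m} {σ : Fin r → Fin n} (t : Fin k → Carrier) {v : Fin k → Pt m} →
      (∀ l → Kernel A σ (v l)) → Kernel A σ (λ j → sumFin (λ l → t l * v l j))
    Kernel-linearCombination {A = A} {σ} t {v} v∈ker l′ =
      trans (dot-linearCombination (A (σ l′)) t v) (sumFin-≈0 (λ l → trans (*-congˡ (v∈ker l l′)) (zeroʳ (t l))))

  addIdx-injective : ∀ {d n} {S : Fin d → Fin n} {j} → Injective _≡_ _≡_ S → (∀ l → S l ≢ j) → Injective _≡_ _≡_ (addIdx S j)
  addIdx-injective S-inj j∉S {zero}  {zero}  e = ≡.refl
  addIdx-injective S-inj j∉S {zero}  {suc l} e = ⊥-elim (j∉S l (≡.sym e))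
  addIdx-injective S-inj j∉S {suc l} {zero}  e = ⊥-elim (j∉S l e)
  addIdx-injective S-inj j∉S {suc l} {suc l′} e = ≡.cong suc (S-inj e)

  missedBy : ∀ {r n} (τ : Fin r → Fin n) → r ℕ.< n → ∃ λ a → ∀ l → τ l ≢ a
  missedBy {r} {n} τ r<n with Finₚ.all? (λ a → Finₚ.any? (λ l → τ l Finₚ.≟ a))
  ... | yes hit = ⊥-elim (ℕₚ.<⇒≱ r<n (Finₚ.injective⇒≤ preimage-injective))
    where
    preimage-injective : Injective _≡_ _≡_ (λ a → proj₁ (hit a))
    preimage-injective {a} {a′} e = ≡.trans (≡.sym (proj₂ (hit a))) (≡.trans (≡.cong τ e) (proj₂ (hit a′)))
  ... | no ¬hit with Finₚ.¬∀⟶∃¬ n _ (λ a → Finₚ.any? (λ l → τ l Finₚ.≟ a)) ¬hit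
  ...   | a , a∉τ = a , λ l e → a∉τ (l , e)

  extendAvoiding : ∀ k {r n} (ρ : Fin r → Fin n) → Injective _≡_ _≡_ ρ → (a : Fin n) → (∀ l → ρ l ≢ a) → suc (k ℕ.+ r) ℕ.≤ n →
    Σ (Fin (k ℕ.+ r) → Fin n) λ τ → Injective _≡_ _≡_ τ × (∀ l → τ l ≢ a) × (∀ l → τ (k ↑ʳ l) ≡ ρ l)
  extendAvoiding zero    ρ ρ-inj a a∉ρ _ = ρ , ρ-inj , a∉ρ , λ l → ≡.refl
  extendAvoiding (suc k) ρ ρ-inj a a∉ρ size with extendAvoiding k ρ ρ-inj a a∉ρ (ℕₚ.<⇒≤ size)
  ... | τ , τ-inj , a∉τ , τ⊇ρ with missedBy (addIdx τ a) size
  ...   | a′ , a′∉ = addIdx τ a′ , addIdx-injective τ-inj (λ l → a′∉ (suc l)) ,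
                     (λ { zero e → a′∉ zero (≡.sym e) ; (suc l) → a∉τ l }) , τ⊇ρ

  module Solvability {n m} (A : Fin n → Pt m) (b : Pt n) (gp : GeneralPosition A b) (m<n : m ℕ.< n) where

    meetAffine : ∀ {r} (σ : Fin r → Fin n) → Injective _≡_ _≡_ σ → r ℕ.≤ m → AffineOfDim (Meet A b σ) (m ℕ.∸ r)
    meetAffine {r} σ σ-inj r≤m = proj₁ (gp r σ σ-inj) r≤m (m ℕ.∸ r) (ℕₚ.m+[n∸m]≡n r≤m)

    -- Extend ρ to m hyperplanes avoiding a: their common vertex lies off H_a,
    -- since no m + 1 hyperplanes of the arrangement meet.
    meet⊈hyperplane : ∀ {r} (ρ : Fin r → Fin n) → Injective _≡_ _≡_ ρ → r ℕ.≤ m → ∀ a → (∀ l → ρ l ≢ a) →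
      ∃ λ w → Meet A b ρ w × ¬ OnH A b a w
    meet⊈hyperplane {r} ρ ρ-inj r≤m a a∉ρ =
      w , w∈ρ , λ w∈a → proj₂ (gp (suc (k ℕ.+ r)) T T-inj) (ℕ.s≤s (ℕₚ.≤-reflexive (≡.sym k+r≡m))) w (w∈T w∈a)
      where
      k : ℕ
      k = m ℕ.∸ r
      k+r≡m : k ℕ.+ r ≡ m
      k+r≡m = ℕₚ.m∸n+n≡m r≤m
      extension : Σ (Fin (k ℕ.+ r) → Fin n) λ τ → Injective _≡_ _≡_ τ × (∀ l → τ l ≢ a) × (∀ l → τ (k ↑ʳ l) ≡ ρ l)
      extension = extendAvoiding k ρ ρ-inj a a∉ρ (≡.subst (λ i → suc i ℕ.≤ n) (≡.sym k+r≡m) m<n)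
      τ : Fin (k ℕ.+ r) → Fin n
      τ = proj₁ extension
      τ-inj : Injective _≡_ _≡_ τ
      τ-inj = proj₁ (proj₂ extension)
      T : Fin (suc (k ℕ.+ r)) → Fin n
      T = addIdx τ a
      T-inj : Injective _≡_ _≡_ T
      T-inj = addIdx-injective τ-inj (proj₁ (proj₂ (proj₂ extension)))
      vertex : AffineOfDim (Meet A b τ) 0
      vertex = proj₁ (gp (k ℕ.+ r) τ τ-inj) (ℕₚ.≤-reflexive k+r≡m) 0 (≡.trans (ℕₚ.+-identityʳ _) k+r≡m)
      w : Pt m
      w = AffineMeet.base A b τ vertex
      w∈ρ : Meet A b ρ w
      w∈ρ l = ≡.subst (λ i → OnH A b i w) (proj₂ (proj₂ (proj₂ extension)) l) (AffineMeet.base∈ A b τ vertex (k ↑ʳ l))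
      w∈T : OnH A b a w → Meet A b T w
      w∈T w∈a zero    = w∈a
      w∈T w∈a (suc l) = AffineMeet.base∈ A b τ vertex l

    -- Otherwise H_{σ 0} would contain the whole intersection of the other hyperplanes.
    row-nonvanishingOnKernel : ∀ {r} (σ : Fin (suc r) → Fin n) → Injective _≡_ _≡_ σ → suc r ℕ.≤ m →
      ¬ (∀ u → Kernel A (σ ∘ suc) u → dot (A (σ zero)) u ≈ 0#)
    row-nonvanishingOnKernel {r} σ σ-inj r<m vanishes with
      meet⊈hyperplane (σ ∘ suc) (λ e → Finₚ.suc-injective (σ-inj e)) (ℕₚ.<⇒≤ r<m) (σ zero) (λ l e → Finₚ.0≢1+n (σ-inj (≡.sym e)))
    ... | w , w∈σ′ , w∉ = w∉ (begin
      dot a w                      ≈⟨ solve 2 (λ x y → x := (x :- y) :+ y) refl (dot a w) (dot a p) ⟩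
      (dot a w - dot a p) + dot a p
        ≈⟨ +-congʳ (trans (sym (dot-difference a p w)) (vanishes _ (meet-difference∈Kernel {A = A} {b} (λ l → p∈σ (suc l)) w∈σ′))) ⟩
      0# + dot a p                 ≈⟨ +-identityˡ _ ⟩
      dot a p                      ≈⟨ p∈σ zero ⟩
      b (σ zero)                   ∎)
      where
      a : Pt m
      a = A (σ zero)
      p : Pt m
      p = AffineMeet.base A b σ (meetAffine σ σ-inj r<m)
      p∈σ : Meet A b σ p
      p∈σ = AffineMeet.base∈ A b σ (meetAffine σ σ-inj r<m)

    solvable : ∀ {r} (σ : Fin r → Fin n) → Injective _≡_ _≡_ σ → r ℕ.≤ m →
      ∀ (y : Fin r → Carrier) → ∃ λ (x : Pt m) → ∀ l → dot (A (σ l)) x ≈ y l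
    solvable {zero}  σ _     _   y = (λ _ → 0#) , λ ()
    solvable {suc r} σ σ-inj r<m y = x , solves
      where
      σ′ : Fin r → Fin n
      σ′ = σ ∘ suc
      σ′-inj : Injective _≡_ _≡_ σ′
      σ′-inj e = Finₚ.suc-injective (σ-inj e)
      x₀ : Pt m
      x₀ = proj₁ (solvable σ′ σ′-inj (ℕₚ.<⇒≤ r<m) (y ∘ suc))
      module M′ = AffineMeet A b σ′ (meetAffine σ′ σ′-inj (ℕₚ.<⇒≤ r<m))
      a : Pt m
      a = A (σ zero)
      g : Fin (m ℕ.∸ r) → Carrier
      g l = dot a (M′.direction l)
      u : Pt m
      u j = sumFin (λ l → g l * M′.direction l j)
      u∈ker : Kernel A σ′ u
      u∈ker = Kernel-linearCombination {A = A} {σ′} g {M′.direction} M′.direction∈Kernel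
      au≉0 : ¬ dot a u ≈ 0#
      au≉0 au≈0 = sumFin-squares≈0 g (trans (sym (dot-linearCombination a g M′.direction)) au≈0) λ g≈0 →
        row-nonvanishingOnKernel σ σ-inj r<m λ u′ u′∈ker →
          let t , u′≈ = M′.kernel⊆span u′ u′∈ker in
          trans (dot-cong a u′≈) (trans (dot-linearCombination a t M′.direction)
                                        (sumFin-≈0 (λ l → trans (*-congˡ (g≈0 l)) (zeroʳ (t l)))))
      ⟨au⟩⁻¹ : Carrier
      ⟨au⟩⁻¹ = proj₁ (inverse (dot a u) au≉0)
      scale : Carrier
      scale = (y zero - dot a x₀) * ⟨au⟩⁻¹
      x : Pt m
      x j = x₀ j + scale * u j
      solves : ∀ l → dot (A (σ l)) x ≈ y l
      solves zero = begin
        dot a x                                         ≈⟨ dot-linear a x₀ u scale ⟩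
        dot a x₀ + scale * dot a u                      ≈⟨ +-congˡ (*-assoc _ _ _) ⟩
        dot a x₀ + (y zero - dot a x₀) * (⟨au⟩⁻¹ * dot a u)
          ≈⟨ +-congˡ (*-congˡ (trans (*-comm _ _) (proj₂ (inverse (dot a u) au≉0)))) ⟩
        dot a x₀ + (y zero - dot a x₀) * 1#            ≈⟨ +-congˡ (*-identityʳ _) ⟩
        dot a x₀ + (y zero - dot a x₀)                 ≈⟨ solve 2 (λ q y → q :+ (y :- q) := y) refl (dot a x₀) (y zero) ⟩
        y zero                                          ∎
      solves (suc l) = begin
        dot (A (σ′ l)) x                                ≈⟨ dot-linear (A (σ′ l)) x₀ u scale ⟩
        dot (A (σ′ l)) x₀ + scale * dot (A (σ′ l)) u    ≈⟨ +-cong (proj₂ (solvable σ′ σ′-inj (ℕₚ.<⇒≤ r<m) (y ∘ suc)) l)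
                                                                  (trans (*-congˡ (u∈ker l)) (zeroʳ scale)) ⟩
        y (suc l) + 0#                                  ≈⟨ +-identityʳ _ ⟩
        y (suc l)                                       ∎

  -- Order of vertices on a line

  Spans : ∀ {n m r} → (Fin n → Pt m) → (Fin r → Fin n) → Pt m → Set (c ⊔ ℓ₁)
  Spans A σ w = ∀ u → Kernel A σ u → ∃ λ s → u ≈ᵥ (λ i → s * w i)

  orientation : ∀ {n m} → (Fin n → Pt m) → (Fin (suc m) → Fin n) → Fin n → Pt m → Carrier
  orientation A J k w = dot (A k) w * concDet A J (δ k)

  module _ {n m} (A : Fin n → Pt m) (J : Fin (suc m) → Fin n) where

    abstract
      concDet-* : ∀ {y y₁ : Pt n} α → (∀ l → y (J l) ≈ α * y₁ (J l)) → concDet A J y ≈ α * concDet A J y₁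
      concDet-* {y} {y₁} α y≈ = begin
        concDet A J y                                   ≈⟨ concDet-linear A J y y₁ y₁ α 0# (λ l → trans (y≈ l) (sym (trans (+-congˡ (zeroˡ _)) (+-identityʳ _)))) ⟩
        α * concDet A J y₁ + 0# * concDet A J y₁        ≈⟨ trans (+-congˡ (zeroˡ _)) (+-identityʳ _) ⟩
        α * concDet A J y₁                              ∎

      -- b - A x vanishes on the hyperplanes through x, and concDet vanishes on A x.
      concDet-atVertex : ∀ {r} (T : Fin r → Fin n) (k : Fin n) → (∀ l → ∃ λ l′ → J l ≡ addIdx T k l′) →
        (∀ l → T l ≢ k) → ∀ {b x} → Meet A b T x →
        concDet A J b ≈ (b k - dot (A k) x) * concDet A J (δ k)
      concDet-atVertex T k J⊆ k∉T {b} {x} x∈ = begin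
        concDet A J b
          ≈⟨ concDet-linear A J b residual (λ i → dot (A i) x) 1# 1# (λ l → sym (trans (+-cong (*-identityˡ _) (*-identityˡ _))
                                                                                     (solve 2 (λ b a → (b :- a) :+ a := b) refl (b (J l)) (dot (A (J l)) x)))) ⟩
        1# * concDet A J residual + 1# * concDet A J (λ i → dot (A i) x)
          ≈⟨ +-cong (*-identityˡ _) (trans (*-congˡ (concDet-columnSpace≈0 A J (λ j → j) x)) (zeroʳ 1#)) ⟩
        concDet A J residual + 0#
          ≈⟨ +-identityʳ _ ⟩
        concDet A J residual
          ≈⟨ concDet-* {residual} {δ k} (b k - dot (A k) x) residual≈ ⟩
        (b k - dot (A k) x) * concDet A J (δ k)
          ∎
        where
        residual : Pt n
        residual i = b i - dot (A i) x
        residual≈ : ∀ l → residual (J l) ≈ (b k - dot (A k) x) * δ k (J l)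
        residual≈ l with J⊆ l
        ... | zero , e = ≡.subst (λ i → residual i ≈ (b k - dot (A k) x) * δ k i) (≡.sym e)
                           (sym (trans (*-congˡ (δ-diag k)) (*-identityʳ _)))
        ... | suc l′ , e = ≡.subst (λ i → residual i ≈ (b k - dot (A k) x) * δ k i) (≡.sym e)
                             (trans (trans (+-congʳ (sym (x∈ l′))) (-‿inverseʳ _))
                                    (sym (trans (*-congˡ (δ-offDiag k (T l′) (k∉T l′))) (zeroʳ _))))

  module PrecedenceCriterion {n d} (A : Fin n → Pt (suc d)) (b : Pt n) {S : Fin d → Fin n} {j k : Fin n}
      {J : Fin (suc (suc d)) → Fin n} (J⊆ : ∀ l → ∃ λ l′ → J l ≡ addIdx (addIdx S j) k l′) (k∉ : ∀ l → addIdx S j l ≢ k)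
      {w : Pt (suc d)} (w-spans : Spans A S w) {p q : Pt (suc d)} (q-p≈w : ∀ i → q i - p i ≈ w i)
      {x y : Pt (suc d)} (x∈ : Meet A b (addIdx S j) x) (y∈ : Meet A b (addIdx S k) y)
      (D≉0 : ¬ concDet A J b ≈ 0#) where

    private
      κ : Carrier
      κ = orientation A J k w

      y-x∈ker : Kernel A S (λ i → y i - x i)
      y-x∈ker = meet-difference∈Kernel {A = A} {b} {S} {x} {y} (λ l → x∈ (suc l)) (λ l → y∈ (suc l))

      concDet≈ : ∀ s → (∀ i → y i - x i ≈ s * w i) → concDet A J b ≈ s * κ
      concDet≈ s y-x≈ = begin
        concDet A J b                                 ≈⟨ concDet-atVertex A J (addIdx S j) k J⊆ k∉ {b} {x} x∈ ⟩
        (b k - dot (A k) x) * concDet A J (δ k)       ≈⟨ *-congʳ (+-congʳ (sym (y∈ zero))) ⟩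
        (dot (A k) y - dot (A k) x) * concDet A J (δ k) ≈⟨ *-congʳ (dot-difference (A k) x y) ⟨
        dot (A k) (λ i → y i - x i) * concDet A J (δ k) ≈⟨ *-congʳ (trans (dot-cong (A k) y-x≈) (dot-scale (A k) w s)) ⟩
        (s * dot (A k) w) * concDet A J (δ k)         ≈⟨ *-assoc _ _ _ ⟩
        s * κ                                         ∎

    orientation≉0 : ¬ orientation A J k w ≈ 0#
    orientation≉0 κ≈0 with w-spans _ y-x∈ker
    ... | s , y-x≈ = D≉0 (trans (concDet≈ s y-x≈) (trans (*-congˡ κ≈0) (zeroʳ s)))

    precedes⇔sameSign : Precedes p q x y ⇔ SameSign (concDet A J b) (orientation A J k w)
    precedes⇔sameSign = mk⇔ to from
      where
      to : Precedes p q x y → SameSign (concDet A J b) κ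
      to (t , 0<t , y≈) = sameSign-resp₂ (sym concDet≈tκ) refl (sameSign-pos* 0<t (λ tκ≈0 → D≉0 (trans concDet≈tκ tκ≈0)))
        where
        y-x≈ : ∀ i → y i - x i ≈ t * w i
        y-x≈ i = begin
          y i - x i                       ≈⟨ +-congʳ (y≈ i) ⟩
          (x i + t * (q i - p i)) - x i   ≈⟨ solve 3 (λ x t v → x :+ t :* v :- x := t :* v) refl (x i) t (q i - p i) ⟩
          t * (q i - p i)                 ≈⟨ *-congˡ (q-p≈w i) ⟩
          t * w i                         ∎
        concDet≈tκ : concDet A J b ≈ t * κ
        concDet≈tκ = concDet≈ t y-x≈
      from : SameSign (concDet A J b) κ → Precedes p q x y
      from same with w-spans _ y-x∈ker
      ... | s , y-x≈ = s , sameSign-*⇒pos (sameSign-resp₂ (concDet≈ s y-x≈) refl same) , λ i → begin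
        y i                      ≈⟨ solve 2 (λ x y → y := x :+ (y :- x)) refl (x i) (y i) ⟩
        x i + (y i - x i)        ≈⟨ +-congˡ (y-x≈ i) ⟩
        x i + s * w i            ≈⟨ +-congˡ (*-congˡ (q-p≈w i)) ⟨
        x i + s * (q i - p i)    ∎

  abstract
    distinct⇒difference≉0 : ∀ {m} {p q : Pt m} → ¬ p ≈ᵥ q → ¬ (∀ i → q i - p i ≈ 0#)
    distinct⇒difference≉0 {p = p} {q} p≉q q-p≈0 = p≉q λ i → sym (begin
      q i                  ≈⟨ solve 2 (λ p q → q := p :+ (q :- p)) refl (p i) (q i) ⟩
      p i + (q i - p i)    ≈⟨ +-congˡ (q-p≈0 i) ⟩
      p i + 0#             ≈⟨ +-identityʳ (p i) ⟩
      p i                  ∎)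

  module Lines {n d} (A : Fin n → Pt (suc d)) (b : Pt n) (gp : GeneralPosition A b)
               {S : Fin d → Fin n} (S-inj : Injective _≡_ _≡_ S) where

    private
      lineS : AffineOfDim (Meet A b S) 1
      lineS = proj₁ (gp d S S-inj) (ℕₚ.n≤1+n d) 1 (ℕₚ.+-comm d 1)

      vertexOf : ∀ {j} → (∀ l → S l ≢ j) → AffineOfDim (Meet A b (addIdx S j)) 0
      vertexOf {j} j∉S = proj₁ (gp (suc d) (addIdx S j) (addIdx-injective S-inj j∉S)) ℕₚ.≤-refl 0 (ℕₚ.+-identityʳ _)

    vertex : ∀ {j} → (∀ l → S l ≢ j) → ∃ (Meet A b (addIdx S j))
    vertex j∉S = AffineMeet.base A b _ (vertexOf j∉S) , AffineMeet.base∈ A b _ (vertexOf j∉S)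

    vertexKernel-trivial : ∀ {j} → (∀ l → S l ≢ j) → ∀ u → Kernel A (addIdx S j) u → ∀ i → u i ≈ 0#
    vertexKernel-trivial j∉S u u∈ker = proj₂ (AffineMeet.kernel⊆span A b _ (vertexOf j∉S) u u∈ker)

    direction-spans : ∀ {p q} → Meet A b S p → Meet A b S q → ¬ p ≈ᵥ q → Spans A S (λ i → q i - p i)
    direction-spans {p} {q} p∈ q∈ p≉q u u∈ker = t zero * t₀⁻¹ , λ i → begin
      u i                                          ≈⟨ u≈ i ⟩
      t zero * v i + 0#                            ≈⟨ +-identityʳ _ ⟩
      t zero * v i                                 ≈⟨ *-identityʳ _ ⟨
      (t zero * v i) * 1#                          ≈⟨ *-congˡ (proj₂ (inverse (t₀ zero) t₀≉0)) ⟨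
      (t zero * v i) * (t₀ zero * t₀⁻¹)
        ≈⟨ solve 4 (λ s v a a⁻¹ → (s :* v) :* (a :* a⁻¹) := (s :* a⁻¹) :* (a :* v :+ con (ℤ.+ 0))) refl (t zero) (v i) (t₀ zero) t₀⁻¹ ⟩
      (t zero * t₀⁻¹) * (t₀ zero * v i + 0#)       ≈⟨ *-congˡ (w≈ i) ⟨
      (t zero * t₀⁻¹) * (q i - p i)                ∎
      where
      lineSpan : ∀ u → Kernel A S u → ∃ λ (t : Fin 1 → Carrier) → u ≈ᵥ (λ i → sumFin (λ l → t l * AffineMeet.direction A b S lineS l i))
      lineSpan = AffineMeet.kernel⊆span A b S lineS
      v : Pt (suc d)
      v = AffineMeet.direction A b S lineS zero
      t : Fin 1 → Carrier
      t = proj₁ (lineSpan u u∈ker)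
      u≈ : ∀ i → u i ≈ t zero * v i + 0#
      u≈ = proj₂ (lineSpan u u∈ker)
      w : Pt (suc d)
      w i = q i - p i
      w∈ker : Kernel A S w
      w∈ker = meet-difference∈Kernel {A = A} {b} {S} {p} {q} p∈ q∈
      t₀ : Fin 1 → Carrier
      t₀ = proj₁ (lineSpan w w∈ker)
      w≈ : ∀ i → w i ≈ t₀ zero * v i + 0#
      w≈ = proj₂ (lineSpan w w∈ker)
      t₀≉0 : ¬ t₀ zero ≈ 0#
      t₀≉0 t₀≈0 = distinct⇒difference≉0 p≉q λ i → trans (w≈ i) (trans (+-identityʳ _) (trans (*-congʳ t₀≈0) (zeroˡ _)))
      t₀⁻¹ : Carrier
      t₀⁻¹ = proj₁ (inverse (t₀ zero) t₀≉0)

    record ParallelLine (b̃ : Pt n) (p q : Pt (suc d)) : Set (c ⊔ ℓ₁) where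
      field
        p̃ q̃       : Pt (suc d)
        p̃∈        : Meet A b̃ S p̃
        q̃∈        : Meet A b̃ S q̃
        p̃≉q̃       : ¬ p̃ ≈ᵥ q̃
        q̃-p̃≈q-p   : ∀ i → q̃ i - p̃ i ≈ q i - p i

    parallelLine : suc d ℕ.< n → ∀ {p q} → Meet A b S p → Meet A b S q → ¬ p ≈ᵥ q → ∀ b̃ → ParallelLine b̃ p q
    parallelLine d<n {p} {q} p∈ q∈ p≉q b̃ = record
      { p̃ = p̃ ; q̃ = q̃ ; p̃∈ = p̃∈ ; q̃∈ = q̃∈ ; p̃≉q̃ = p̃≉q̃ ; q̃-p̃≈q-p = q̃-p̃≈w }
      where
      w : Pt (suc d)
      w i = q i - p i
      solution : ∃ λ (x : Pt (suc d)) → ∀ l → dot (A (S l)) x ≈ b̃ (S l)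
      solution = Solvability.solvable A b gp d<n S S-inj (ℕₚ.n≤1+n d) (λ l → b̃ (S l))
      p̃ q̃ : Pt (suc d)
      p̃ = proj₁ solution
      q̃ i = p̃ i + w i
      p̃∈ : Meet A b̃ S p̃
      p̃∈ = proj₂ solution
      q̃∈ : Meet A b̃ S q̃
      q̃∈ l = begin
        dot (A (S l)) q̃                          ≈⟨ dot-cong (A (S l)) {y = λ i → p̃ i + 1# * w i} (λ i → +-congˡ (sym (*-identityˡ (w i)))) ⟩
        dot (A (S l)) (λ i → p̃ i + 1# * w i)     ≈⟨ dot-linear (A (S l)) p̃ w 1# ⟩
        dot (A (S l)) p̃ + 1# * dot (A (S l)) w   ≈⟨ +-cong (p̃∈ l) (trans (*-congˡ (meet-difference∈Kernel {A = A} {b} {S} {p} {q} p∈ q∈ l)) (zeroʳ 1#)) ⟩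
        b̃ (S l) + 0#                             ≈⟨ +-identityʳ _ ⟩
        b̃ (S l)                                  ∎
      q̃-p̃≈w : ∀ i → q̃ i - p̃ i ≈ w i
      q̃-p̃≈w i = solve 2 (λ p w → p :+ w :- p := w) refl (p̃ i) (w i)
      p̃≉q̃ : ¬ p̃ ≈ᵥ q̃
      p̃≉q̃ p̃≈q̃ = distinct⇒difference≉0 p≉q λ i → trans (sym (q̃-p̃≈w i)) (trans (+-congʳ (sym (p̃≈q̃ i))) (-‿inverseʳ _))

    notPrecedes-sameVertex : ∀ {j} → (∀ l → S l ≢ j) → ∀ {b̃ : Pt n} {p̃ q̃ x̃ ỹ} → ¬ (∀ i → q̃ i - p̃ i ≈ 0#) →
      Meet A b̃ (addIdx S j) x̃ → Meet A b̃ (addIdx S j) ỹ → ¬ Precedes p̃ q̃ x̃ ỹ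
    notPrecedes-sameVertex j∉S {b̃} {p̃} {q̃} {x̃} {ỹ} q̃-p̃≉0 x̃∈ ỹ∈ (t , 0<t , ỹ≈) =
      q̃-p̃≉0 λ i → x*y≈0⇒y≈0 (0<x⇒x≉0 0<t) (begin
        t * (q̃ i - p̃ i)                   ≈⟨ solve 3 (λ x t v → t :* v := x :+ t :* v :- x) refl (x̃ i) t (q̃ i - p̃ i) ⟩
        (x̃ i + t * (q̃ i - p̃ i)) - x̃ i     ≈⟨ +-congʳ (ỹ≈ i) ⟨
        ỹ i - x̃ i                         ≈⟨ vertexKernel-trivial j∉S (λ i → ỹ i - x̃ i) (meet-difference∈Kernel {A = A} {b̃} {addIdx S _} {x̃} {ỹ} x̃∈ ỹ∈) i ⟩
        0#                                ∎)

  crossing-flipTogether : ∀ {n m} {A A′ : Fin n → Pt m} {I J : Fin (suc m) → Fin n} {b b̃ c′ c̃ : Pt n} →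
    CrossesOnly A I b b̃ → CrossesOnly A′ I c′ c̃ → StrictlyIncreasing J →
    FlipTogether (concDet A J b) (concDet A J b̃) (concDet A′ J c′) (concDet A′ J c̃)
  crossing-flipTogether {A = A} {A′} {I} {J} {b} {b̃} {c′} {c̃} (_ , keep , flip) (_ , keep′ , flip′) J-inc
    with Finₚ.all? (λ l → J l Finₚ.≟ I l)
  ... | yes J≗I = inj₂ (oppositeSign-resp₂ (sym (concDet-congIndices A b J≗I)) (sym (concDet-congIndices A b̃ J≗I)) flip ,
                        oppositeSign-resp₂ (sym (concDet-congIndices A′ c′ J≗I)) (sym (concDet-congIndices A′ c̃ J≗I)) flip′)
  ... | no  J≉I = inj₁ (keep J J-inc J≉I , keep′ J J-inc J≉I)

  module Crossing {n d} {A A′ : Fin n → Pt (suc d)} {b c′ b̃ c̃ : Pt n} {I : Fin (suc (suc d)) → Fin n}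
      (gp : GeneralPosition A b) (gp′ : GeneralPosition A′ c′) (cone : InConeInterior A b) (cone′ : InConeInterior A′ c′)
      (I-inc : StrictlyIncreasing I) (cr : CrossesOnly A I b b̃) (cr′ : CrossesOnly A′ I c′ c̃)
      {S : Fin d → Fin n} (S-inj : Injective _≡_ _≡_ S)
      {p q p′ q′ : Pt (suc d)} (p∈ : Meet A b S p) (q∈ : Meet A b S q) (p≉q : ¬ p ≈ᵥ q)
      (p′∈ : Meet A′ c′ S p′) (q′∈ : Meet A′ c′ S q′) (p′≉q′ : ¬ p′ ≈ᵥ q′)
      (sameOrder : ∀ j k → (∀ l → ¬ (S l ≡ j)) → (∀ l → ¬ (S l ≡ k)) → ∀ x y x′ y′ →
         Meet A b (addIdx S j) x → Meet A b (addIdx S k) y → Meet A′ c′ (addIdx S j) x′ → Meet A′ c′ (addIdx S k) y′ →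
         (Precedes p q x y → Precedes p′ q′ x′ y′) × (Precedes p′ q′ x′ y′ → Precedes p q x y)) where

    module L  = Lines A b gp S-inj
    module L′ = Lines A′ c′ gp′ S-inj

    d<n : suc d ℕ.< n
    d<n = Finₚ.injective⇒≤ (increasing⇒injective I I-inc)

    -- The new lines are parallel to the old ones with the same orientation, so that the
    -- orientation constant of PrecedenceCriterion is shared by the old and the new arrangement.
    module N  = L.ParallelLine (L.parallelLine d<n p∈ q∈ p≉q b̃)
    module N′ = L′.ParallelLine (L′.parallelLine d<n p′∈ q′∈ p′≉q′ c̃)

    newOrder-distinct : ∀ {j k} → j ≢ k → (∀ l → S l ≢ j) → (∀ l → S l ≢ k) → ∀ {x̃ ỹ x̃′ ỹ′} →
      Meet A b̃ (addIdx S j) x̃ → Meet A b̃ (addIdx S k) ỹ → Meet A′ c̃ (addIdx S j) x̃′ → Meet A′ c̃ (addIdx S k) ỹ′ →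
      Precedes N.p̃ N.q̃ x̃ ỹ ⇔ Precedes N′.p̃ N′.q̃ x̃′ ỹ′
    newOrder-distinct {j} {k} j≢k j∉S k∉S {x̃} {ỹ} {x̃′} {ỹ′} x̃∈ ỹ∈ x̃′∈ ỹ′∈ =
      ⇔.trans New.precedes⇔sameSign
        (⇔.trans (sameSign-transfer⇔ (crossing-flipTogether {A = A} {A′} {I} {J} {b} {b̃} {c′} {c̃} cr cr′ J-inc) Old.orientation≉0 Old′.orientation≉0 oldSigns)
                 (⇔.sym New′.precedes⇔sameSign))
      where
      k∉Sj : ∀ l → addIdx S j l ≢ k
      k∉Sj zero    = j≢k
      k∉Sj (suc l) = k∉S l
      enumeration = increasingEnumeration (addIdx (addIdx S j) k) (addIdx-injective (addIdx-injective S-inj j∉S) k∉Sj)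
      J : Fin (suc (suc d)) → Fin n
      J = proj₁ enumeration
      J-inc : StrictlyIncreasing J
      J-inc = proj₁ (proj₂ enumeration)
      J⊆ : ∀ l → ∃ λ l′ → J l ≡ addIdx (addIdx S j) k l′
      J⊆ = proj₂ (proj₂ enumeration)
      x y x′ y′ : Pt (suc d)
      x  = proj₁ (L.vertex j∉S)
      y  = proj₁ (L.vertex k∉S)
      x′ = proj₁ (L′.vertex j∉S)
      y′ = proj₁ (L′.vertex k∉S)
      module Old  = PrecedenceCriterion A b J⊆ k∉Sj (L.direction-spans p∈ q∈ p≉q) {p} {q} (λ i → refl)
                      {x} {y} (proj₂ (L.vertex j∉S)) (proj₂ (L.vertex k∉S)) (cone J J-inc)
      module New  = PrecedenceCriterion A b̃ J⊆ k∉Sj (L.direction-spans p∈ q∈ p≉q) N.q̃-p̃≈q-p {x̃} {ỹ} x̃∈ ỹ∈ (proj₁ cr J J-inc)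
      module Old′ = PrecedenceCriterion A′ c′ J⊆ k∉Sj (L′.direction-spans p′∈ q′∈ p′≉q′) {p′} {q′} (λ i → refl)
                      {x′} {y′} (proj₂ (L′.vertex j∉S)) (proj₂ (L′.vertex k∉S)) (cone′ J J-inc)
      module New′ = PrecedenceCriterion A′ c̃ J⊆ k∉Sj (L′.direction-spans p′∈ q′∈ p′≉q′) N′.q̃-p̃≈q-p {x̃′} {ỹ′} x̃′∈ ỹ′∈ (proj₁ cr′ J J-inc)
      oldOrder : (Precedes p q x y → Precedes p′ q′ x′ y′) × (Precedes p′ q′ x′ y′ → Precedes p q x y)
      oldOrder = sameOrder j k j∉S k∉S x y x′ y′ (proj₂ (L.vertex j∉S)) (proj₂ (L.vertex k∉S))
                                                 (proj₂ (L′.vertex j∉S)) (proj₂ (L′.vertex k∉S))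
      oldSigns : SameSign (concDet A J b) (orientation A J k (λ i → q i - p i)) ⇔
                 SameSign (concDet A′ J c′) (orientation A′ J k (λ i → q′ i - p′ i))
      oldSigns = ⇔.trans (⇔.sym Old.precedes⇔sameSign) (⇔.trans (mk⇔ (proj₁ oldOrder) (proj₂ oldOrder)) Old′.precedes⇔sameSign)

    newOrder : ∀ j k → (∀ l → S l ≢ j) → (∀ l → S l ≢ k) → ∀ {x̃ ỹ x̃′ ỹ′} →
      Meet A b̃ (addIdx S j) x̃ → Meet A b̃ (addIdx S k) ỹ → Meet A′ c̃ (addIdx S j) x̃′ → Meet A′ c̃ (addIdx S k) ỹ′ →
      Precedes N.p̃ N.q̃ x̃ ỹ ⇔ Precedes N′.p̃ N′.q̃ x̃′ ỹ′
    newOrder j k j∉S k∉S x̃∈ ỹ∈ x̃′∈ ỹ′∈ with j Finₚ.≟ k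
    ... | no  j≢k    = newOrder-distinct j≢k j∉S k∉S x̃∈ ỹ∈ x̃′∈ ỹ′∈
    ... | yes ≡.refl =
      mk⇔ (λ pr → ⊥-elim (L.notPrecedes-sameVertex j∉S {b̃} (distinct⇒difference≉0 N.p̃≉q̃) x̃∈ ỹ∈ pr))
          (λ pr → ⊥-elim (L′.notPrecedes-sameVertex j∉S {c̃} (distinct⇒difference≉0 N′.p̃≉q̃) x̃′∈ ỹ′∈ pr))

  isoId-preservedByCrossing : ∀ {n d} {A A′ : Fin n → Pt (suc d)} {b c′ b̃ c̃ : Pt n} {I : Fin (suc (suc d)) → Fin n} →
    GeneralPosition A b → GeneralPosition A′ c′ → IsoId A b A′ c′ → InConeInterior A b → InConeInterior A′ c′ →
    StrictlyIncreasing I → CrossesOnly A I b b̃ → CrossesOnly A′ I c′ c̃ → IsoId A b̃ A′ c̃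
  isoId-preservedByCrossing {A = A} {A′} {b} {c′} {b̃} {c̃} {I} gp gp′ iso cone cone′ I-inc cr cr′ S S-inj with iso S S-inj
  ... | p , q , p′ , q′ , p∈ , q∈ , p≉q , p′∈ , q′∈ , p′≉q′ , sameOrder =
    C.N.p̃ , C.N.q̃ , C.N′.p̃ , C.N′.q̃ , C.N.p̃∈ , C.N.q̃∈ , C.N.p̃≉q̃ ,
    C.N′.p̃∈ , C.N′.q̃∈ , C.N′.p̃≉q̃ ,
    λ j k j∉S k∉S x̃ ỹ x̃′ ỹ′ x̃∈ ỹ∈ x̃′∈ ỹ′∈ →
      Equivalence.to (C.newOrder j k j∉S k∉S x̃∈ ỹ∈ x̃′∈ ỹ′∈) , Equivalence.from (C.newOrder j k j∉S k∉S x̃∈ ỹ∈ x̃′∈ ỹ′∈)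
    where
    module C = Crossing {A = A} {A′} {b} {c′} {b̃} {c̃} {I} gp gp′ cone cone′ I-inc cr cr′ S-inj p∈ q∈ p≉q p′∈ q′∈ p′≉q′ sameOrder

mainTheorem3 : ∀ {c ℓ₁ ℓ₂ : Level} (𝔽 : OrderedField c ℓ₁ ℓ₂) → let open Geometry 𝔽 in
    ∀ (n d : ℕ)
      (A A′ : Fin n → Pt (suc d)) (b c′ b̃ c̃ : Pt n)
      (I : Fin (suc (suc d)) → Fin n) →
      GeneralPosition A b → GeneralPosition A′ c′ →
      IsoId A b A′ c′ →
      InConeInterior A b → InConeInterior A′ c′ →
      StrictlyIncreasing I →
      SimplexPolyhedrality A b I → SimplexPolyhedrality A′ c′ I →
      CrossesOnly A I b b̃ → CrossesOnly A′ I c′ c̃ →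
      IsoId A b̃ A′ c̃
mainTheorem3 𝔽 n d A A′ b c′ b̃ c̃ I gp gp′ iso cone cone′ I-inc _ _ cr cr′ =
  isoId-preservedByCrossing 𝔽 {A = A} {A′} {b} {c′} {b̃} {c̃} {I} gp gp′ iso cone cone′ I-inc cr cr′
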